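{- Let $\mathbf{Q}=(L,Q_1,\ldots,Q_n,R)$ be a $(4,2)$-flexipath in a matroid $M$, where $n\ge 2$ and $n\ne 3$. Assume $\mathbf{Q}$ is neither squashed nor stretched and has no specially placed steps. Then exactly one of the following holds for all distinct $i,j\in[n]$: (i) $\sqcap(Q_i,Q_j)=0$ and $\sqcap^*(Q_i,Q_j)=1$; (ii) $\sqcap(Q_i,Q_j)=1$ and $\sqcap^*(Q_i,Q_j)=0$; (iii) $n=2$ and $\sqcap(Q_i,Q_j)=0=\sqcap^*(Q_i,Q_j)$, while $\sqcap(L,R)=1=\sqcap^*(L,R)$.
   Context: Let $M$ be a matroid on ground set $E$ with rank function $r$. $\lambda(A)=r(A)+r(E-A)-r(M)$; for disjoint $X,Y$, $\sqcap(X,Y)=r(X)+r(Y)-r(X\cup Y)$ and $\sqcap^*(X,Y)$ is the same quantity in $M^*$; $\kappa(X,Y)=\min\{\lambda(Z):X\subseteq Z\subseteq E-Y\}$. A path of $4$-separations is an ordered partition $(L,P_1,\ldots,P_n,R)$ of $E$ with $\kappa(L,R)=3$ and $\lambda(L\cup P_1\cup\cdots\cup P_i)=3$ for all $i\in\{0,\ldots,n\}$; a $4$-flexipath if this holds for every reordering of $P_1,\ldots,P_n$ (with $L,R$ fixed); a $(4,2)$-flexipath if moreover $\lambda(P_i)=2$ for all $i$ and $\lambda(P_i\cup P_j)>2$ for all distinct $i,j$. A step $Q_i$ is specially placed if either $\sqcap(L,R)=2$ and $\sqcap(L,Q_i)=2=\sqcap(R,Q_i)$, or $\sqcap^*(L,R)=2$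 and $\sqcap^*(L,Q_i)=2=\sqcap^*(R,Q_i)$. $\mathbf{Q}$ is squashed if $\sqcap(L,R)=3$, $\sqcap^*(L,R)=0$, $\sqcap(Q_i,Q_j)=1$ and $\sqcap^*(Q_i,Q_j)=0$ for all distinct $i,j$, and $\sqcap(Q_i,L)=\sqcap(Q_i,R)=2$, $\sqcap^*(Q_i,L)=\sqcap^*(Q_i,R)=0$ for all $i$. $\mathbf{Q}$ is stretched if $\sqcap(L,R)=0$, $\sqcap^*(L,R)=3$, $\sqcap(Q_i,Q_j)=0$ and $\sqcap^*(Q_i,Q_j)=1$ for all distinct $i,j$, and $\sqcap(Q_i,L)=\sqcap(Q_i,R)=0$, $\sqcap^*(Q_i,L)=\sqcap^*(Q_i,R)=2$ for all $i$. -}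

module Defs where

open import Data.Nat using (ℕ; zero; suc; _+_; _∸_; _≤_; _≥_)
open import Data.Fin using (Fin; toℕ)
open import Data.Fin.Subset using (Subset; _⊆_; _∩_; _∪_; ∁; ∣_∣; _∈_; Empty; ⊥; ⊤)
open import Data.Fin.Permutation using (Permutation′; _⟨$⟩ʳ_)
open import Data.List using (List; []; _∷_; map; take; allFin; foldr)
open import Data.Product using (_×_; ∃; ∃-syntax)
open import Data.Sum using (_⊎_)
open import Relation.Binary.PropositionalEquality using (_≡_; _≢_)
open import Relation.Nullary using (¬_)

record Matroid (m : ℕ) : Set where
  field
    r           : Subset m → ℕ
    r-bounded   : ∀ X → r X ≤ ∣ X ∣
    r-monotone  : ∀ {X Y} → X ⊆ Y → r X ≤ r Y
    r-submod    : ∀ X Y → r (X ∪ Y) + r (X ∩ Y) ≤ r X + r Y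

⋃ : ∀ {m} → List (Subset m) → Subset m
⋃ = foldr _∪_ ⊥

module _ {m : ℕ} (M : Matroid m) where
  open Matroid M

  rM : ℕ
  rM = r ⊤

  r* : Subset m → ℕ
  r* X = (∣ X ∣ + r (∁ X)) ∸ rM

  λ' : Subset m → ℕ
  λ' A = (r A + r (∁ A)) ∸ rM

  -- local connectivity ⊓(X,Y) = r(X) + r(Y) - r(X ∪ Y)  (nonnegative by submodularity)
  ⊓ : Subset m → Subset m → ℕ
  ⊓ X Y = (r X + r Y) ∸ r (X ∪ Y)

  ⊓* : Subset m → Subset m → ℕ
  ⊓* X Y = (r* X + r* Y) ∸ r* (X ∪ Y)

  κ≡ : Subset m → Subset m → ℕ → Set
  κ≡ X Y k = (∃[ Z ] (X ⊆ Z × Z ⊆ ∁ Y × λ' Z ≡ k))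
           × (∀ Z → X ⊆ Z → Z ⊆ ∁ Y → k ≤ λ' Z)

  IsOrderedPartition : (n : ℕ) → Subset m → (Fin n → Subset m) → Subset m → Set
  IsOrderedPartition n L P R =
      Empty (L ∩ R)
    × (∀ i → Empty (L ∩ P i))
    × (∀ i → Empty (P i ∩ R))
    × (∀ i j → i ≢ j → Empty (P i ∩ P j))
    × (∀ e → e ∈ L ⊎ ((∃[ i ] e ∈ P i) ⊎ e ∈ R))

  IsPath4 : (n : ℕ) → Subset m → (Fin n → Subset m) → Subset m → Set
  IsPath4 n L P R =
      IsOrderedPartition n L P R
    × κ≡ L R 3
    × (∀ (k : Fin (suc n)) → λ' (L ∪ ⋃ (take (toℕ k) (map P (allFin n)))) ≡ 3)

  Is4Flexipath : (n : ℕ) → Subset m → (Fin n → Subset m) → Subset m → Set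
  Is4Flexipath n L P R =
    ∀ (σ : Permutation′ n) → IsPath4 n L (λ i → P (σ ⟨$⟩ʳ i)) R

  Is42Flexipath : (n : ℕ) → Subset m → (Fin n → Subset m) → Subset m → Set
  Is42Flexipath n L P R =
      Is4Flexipath n L P R
    × (∀ i → λ' (P i) ≡ 2)
    × (∀ i j → i ≢ j → λ' (P i ∪ P j) ≥ 3)

  SpeciallyPlaced : ∀ {n} → Subset m → (Fin n → Subset m) → Subset m → Fin n → Set
  SpeciallyPlaced L Q R i =
      (⊓ L R ≡ 2 × ⊓ L (Q i) ≡ 2 × ⊓ R (Q i) ≡ 2)
    ⊎ (⊓* L R ≡ 2 × ⊓* L (Q i) ≡ 2 × ⊓* R (Q i) ≡ 2)

  Squashed : ∀ {n} → Subset m → (Fin n → Subset m) → Subset m → Set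
  Squashed L Q R =
      ⊓ L R ≡ 3 × ⊓* L R ≡ 0
    × (∀ i j → i ≢ j → ⊓ (Q i) (Q j) ≡ 1 × ⊓* (Q i) (Q j) ≡ 0)
    × (∀ i → ⊓ (Q i) L ≡ 2 × ⊓ (Q i) R ≡ 2 × ⊓* (Q i) L ≡ 0 × ⊓* (Q i) R ≡ 0)

  Stretched : ∀ {n} → Subset m → (Fin n → Subset m) → Subset m → Set
  Stretched L Q R =
      ⊓ L R ≡ 0 × ⊓* L R ≡ 3
    × (∀ i j → i ≢ j → ⊓ (Q i) (Q j) ≡ 0 × ⊓* (Q i) (Q j) ≡ 1)
    × (∀ i → ⊓ (Q i) L ≡ 0 × ⊓ (Q i) R ≡ 0 × ⊓* (Q i) L ≡ 2 × ⊓* (Q i) R ≡ 2)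

ExactlyOne : Set → Set → Set → Set
ExactlyOne A B C = (A × ¬ B × ¬ C) ⊎ ((¬ A × B × ¬ C) ⊎ (¬ A × ¬ B × C))

module Submission where

-- Write αᵢ = ⊓(L,Qᵢ).  From λ(L) = λ(L ∪ Qᵢ) = 3 = λ(R ∪ Qᵢ), λ(Qᵢ) = 2 and λ(Qᵢ ∪ Qⱼ) ≥ 3 one
-- gets αᵢ + ⊓*(L,Qᵢ) = 2, ⊓(R,Qᵢ) = αᵢ, ⊓(Qᵢ,Qⱼ) ≤ αᵢ, ⊓(Qᵢ,Qⱼ) + ⊓*(Qᵢ,Qⱼ) ≤ 1 and
-- 2αᵢ − 2 ≤ ⊓(L,R) ≤ αⱼ + 1, so αᵢ = 2 and αⱼ = 1 make Qᵢ specially placed.  The dual matroid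
-- has the same connectivity function and exchanges ⊓ and ⊓*, so all of this dualises.
-- For n = 2 with ⊓(Q₀,Q₁) = ⊓*(Q₀,Q₁) = 0, the complement of L ∪ R is Q₀ ∪ Q₁; this forces
-- ⊓(L,R) + ⊓*(L,R) = 2 and α₀ + α₁ ≤ ⊓(L,R) + 1 (and dually), and ⊓(L,R) = 2 or ⊓*(L,R) = 2
-- would produce a specially placed step.
-- For n ≥ 4, submodularity of λ on L ∪ Qᵢ ∪ Qⱼ and the complement of L ∪ Qₚ ∪ Q_q gives
-- λ(Qᵢ ∪ Qⱼ) = 3, that is ⊓ + ⊓* = 1 on every pair.  Then α is constant; α ≡ 2 gives (ii) and
-- α ≡ 0 gives (i).  If α ≡ 1, no Qₐ has ⊓(Qₐ,Q_b) = 1 = ⊓*(Qₐ,Q_c), so ⊓ is the same on all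
-- pairs.

open import Defs
import Algebra.Lattice.Properties.BooleanAlgebra as BooleanAlgebraProperties
open import Data.Bool using (true; false)
open import Data.Fin using (Fin; zero; suc; toℕ; fromℕ; inject₁; _≟_; punchIn; punchOut)
open import Data.Fin.Permutation as Perm using (Permutation′; _⟨$⟩ʳ_; _⟨$⟩ˡ_)
open import Data.Fin.Properties
  using (toℕ-injective; toℕ-fromℕ; toℕ≤pred[n]; toℕ-inject₁;
         punchInᵢ≢i; punchIn-injective; punchIn-punchOut)
open import Data.Fin.Subset
  using (Subset; _⊆_; _∩_; _∪_; ∁; ∣_∣; _∈_; _∉_; Empty; ⊥; ⊤)
open import Data.Fin.Subset.Properties
open import Data.Nat using (ℕ; zero; suc; _+_; _∸_; _≤_; _<_; _≥_; z≤n; s≤s)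
open import Data.Nat.Properties
  using (module ≤-Reasoning; +-commutativeSemigroup; +-suc; +-comm; +-assoc; +-identityʳ;
         m+[n∸m]≡n; m∸n+n≡m; n≤0⇒n≡0; m+n≡0⇒m≡0; m+n≤o⇒n≤o; suc-injective;
         ≤-trans; ≤-reflexive; ≤-antisym; <-irrefl; m≤m+n; m≤n⇒m<n∨m≡n;
         +-monoˡ-≤; +-monoʳ-≤; +-mono-≤; +-cancelʳ-≤; +-cancelˡ-≤; +-cancelʳ-≡; +-cancelˡ-≡)
open import Algebra.Properties.CommutativeSemigroup +-commutativeSemigroup
  using (xy∙z≈zx∙y; x∙yz≈xz∙y)
open import Data.Nat.Tactic.RingSolver using (solve)
open import Data.List using ([]; _∷_; take; map; allFin; tabulate)
open import Data.List.Properties using (map-tabulate)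
open import Data.Product using (_×_; _,_; proj₁; proj₂; ∃; ∃-syntax)
open import Data.Sum using (_⊎_; inj₁; inj₂; [_,_]′)
open import Relation.Binary.PropositionalEquality
open import Function using (case_of_)
open import Relation.Nullary using (¬_; yes; no; contradiction)
open import Relation.Nullary.Decidable using (dec-true)

module _ {m : ℕ} where

  private
    module 𝔹 = BooleanAlgebraProperties (∪-∩-booleanAlgebra m)

  ∁-involutive : (X : Subset m) → ∁ (∁ X) ≡ X
  ∁-involutive = 𝔹.¬-involutive

  ∁-∩ : (X Y : Subset m) → ∁ (X ∩ Y) ≡ ∁ X ∪ ∁ Y
  ∁-∩ = 𝔹.deMorgan₁

  ∁-∪ : (X Y : Subset m) → ∁ (X ∪ Y) ≡ ∁ X ∩ ∁ Y
  ∁-∪ = 𝔹.deMorgan₂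

  ∁-⊤ : ∁ ⊤ ≡ ⊥ {m}
  ∁-⊤ = 𝔹.¬⊤≈⊥

  ∉-of-disjoint : {X Y : Subset m} {x : Fin m} → Empty (X ∩ Y) → x ∈ X → x ∉ Y
  ∉-of-disjoint X∩Y≡∅ x∈X x∈Y = X∩Y≡∅ (_ , x∈p∩q⁺ (x∈X , x∈Y))

  ∉-∪ : {X Y : Subset m} {x : Fin m} → x ∉ X → x ∉ Y → x ∉ X ∪ Y
  ∉-∪ {X} {Y} x∉X x∉Y x∈X∪Y = [ x∉X , x∉Y ]′ (x∈p∪q⁻ X Y x∈X∪Y)

  ⊆-∁-of-disjoint : {X Y : Subset m} → Empty (X ∩ Y) → Y ⊆ ∁ X
  ⊆-∁-of-disjoint X∩Y≡∅ x∈Y = x∉p⇒x∈∁p (λ x∈X → ∉-of-disjoint X∩Y≡∅ x∈X x∈Y)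

  disjoint-sym : {X Y : Subset m} → Empty (X ∩ Y) → Empty (Y ∩ X)
  disjoint-sym {X} {Y} X∩Y≡∅ rewrite ∩-comm Y X = X∩Y≡∅

  ⊆-∁-∪ : {X Y Z : Subset m} → Empty (X ∩ Z) → Empty (Y ∩ Z) → Z ⊆ ∁ (X ∪ Y)
  ⊆-∁-∪ {X} {Y} X∩Z≡∅ Y∩Z≡∅ x∈Z = x∉p⇒x∈∁p λ x∈X∪Y →
    [ (λ x∈X → ∉-of-disjoint X∩Z≡∅ x∈X x∈Z) , (λ x∈Y → ∉-of-disjoint Y∩Z≡∅ x∈Y x∈Z) ]′
      (x∈p∪q⁻ X Y x∈X∪Y)

  ∪-⊆-∁ : {X Y Z : Subset m} → Empty (X ∩ Z) → Empty (Y ∩ Z) → X ∪ Y ⊆ ∁ Z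
  ∪-⊆-∁ {X} {Y} X∩Z≡∅ Y∩Z≡∅ x∈X∪Y =
    [ ⊆-∁-of-disjoint (disjoint-sym X∩Z≡∅) , ⊆-∁-of-disjoint (disjoint-sym Y∩Z≡∅) ]′
      (x∈p∪q⁻ X Y x∈X∪Y)

  disjoint-∪ : {X Y Z : Subset m} → Empty (X ∩ Z) → Empty (Y ∩ Z) → Empty ((X ∪ Y) ∩ Z)
  disjoint-∪ {X} {Y} {Z} X∩Z≡∅ Y∩Z≡∅ (x , x∈) with x∈p∩q⁻ (X ∪ Y) Z x∈
  ... | x∈X∪Y , x∈Z = x∈∁p⇒x∉p (⊆-∁-∪ X∩Z≡∅ Y∩Z≡∅ x∈Z) x∈X∪Y

  p⊆q⇒p∪q≡q : {Y Z : Subset m} → Y ⊆ Z → Y ∪ Z ≡ Z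
  p⊆q⇒p∪q≡q {Y} {Z} Y⊆Z = ⊆-antisym
    (λ x∈Y∪Z → [ Y⊆Z , (λ x∈Z → x∈Z) ]′ (x∈p∪q⁻ Y Z x∈Y∪Z))
    (q⊆p∪q Y Z)

  ∪-∁-∪ : (X Y : Subset m) → Empty (X ∩ Y) → Y ∪ ∁ (X ∪ Y) ≡ ∁ X
  ∪-∁-∪ X Y X∩Y≡∅ = begin
    Y ∪ ∁ (X ∪ Y)           ≡⟨ cong (Y ∪_) (𝔹.deMorgan₂ X Y) ⟩
    Y ∪ (∁ X ∩ ∁ Y)         ≡⟨ ∪-distribˡ-∩ Y (∁ X) (∁ Y) ⟩
    (Y ∪ ∁ X) ∩ (Y ∪ ∁ Y)   ≡⟨ cong ((Y ∪ ∁ X) ∩_) (∪-inverseʳ Y) ⟩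
    (Y ∪ ∁ X) ∩ ⊤           ≡⟨ ∩-identityʳ (Y ∪ ∁ X) ⟩
    Y ∪ ∁ X                 ≡⟨ p⊆q⇒p∪q≡q (⊆-∁-of-disjoint X∩Y≡∅) ⟩
    ∁ X                     ∎
    where open ≡-Reasoning

  ∪-∩-∪ : (X A B : Subset m) → Empty (A ∩ B) → (X ∪ A) ∩ (X ∪ B) ≡ X
  ∪-∩-∪ X A B A∩B≡∅ = begin
    (X ∪ A) ∩ (X ∪ B)   ≡⟨ ∪-distribˡ-∩ X A B ⟨
    X ∪ (A ∩ B)         ≡⟨ cong (X ∪_) (Empty-unique A∩B≡∅) ⟩
    X ∪ ⊥               ≡⟨ ∪-identityʳ X ⟩
    X                   ∎
    where open ≡-Reasoning

  ∪-∪-∪ : (X A B : Subset m) → (X ∪ A) ∪ (X ∪ B) ≡ X ∪ (A ∪ B)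
  ∪-∪-∪ X A B = begin
    (X ∪ A) ∪ (X ∪ B)   ≡⟨ ∪-assoc X A (X ∪ B) ⟩
    X ∪ (A ∪ (X ∪ B))   ≡⟨ cong (X ∪_) (∪-assoc A X B) ⟨
    X ∪ ((A ∪ X) ∪ B)   ≡⟨ cong (λ Y → X ∪ (Y ∪ B)) (∪-comm A X) ⟩
    X ∪ ((X ∪ A) ∪ B)   ≡⟨ cong (X ∪_) (∪-assoc X A B) ⟩
    X ∪ (X ∪ (A ∪ B))   ≡⟨ ∪-assoc X X (A ∪ B) ⟨
    (X ∪ X) ∪ (A ∪ B)   ≡⟨ cong (_∪ (A ∪ B)) (∪-idem X) ⟩
    X ∪ (A ∪ B)         ∎
    where open ≡-Reasoning

  ∪-∩-∁-∪ : (X S T : Subset m) → Empty (X ∩ S) → Empty (S ∩ T) → (X ∪ S) ∩ ∁ (X ∪ T) ≡ S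
  ∪-∩-∁-∪ X S T X∩S≡∅ S∩T≡∅ = ⊆-antisym ⊆S S⊆
    where
    ⊆S : (X ∪ S) ∩ ∁ (X ∪ T) ⊆ S
    ⊆S {x} x∈ with x∈p∩q⁻ (X ∪ S) (∁ (X ∪ T)) x∈
    ... | x∈X∪S , x∈∁ =
      [ (λ x∈X → contradiction (x∈p∪q⁺ (inj₁ x∈X)) (x∈∁p⇒x∉p x∈∁)) , (λ x∈S → x∈S) ]′
        (x∈p∪q⁻ X S x∈X∪S)
    S⊆ : S ⊆ (X ∪ S) ∩ ∁ (X ∪ T)
    S⊆ x∈S = x∈p∩q⁺ (q⊆p∪q X S x∈S , ⊆-∁-∪ X∩S≡∅ (disjoint-sym S∩T≡∅) x∈S)

  ∪-∪-∁-∪ : (X S T : Subset m) → Empty (X ∩ T) → Empty (S ∩ T) → (X ∪ S) ∪ ∁ (X ∪ T) ≡ ∁ T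
  ∪-∪-∁-∪ X S T X∩T≡∅ S∩T≡∅ = ⊆-antisym ⊆∁T ∁T⊆
    where
    ⊆∁T : (X ∪ S) ∪ ∁ (X ∪ T) ⊆ ∁ T
    ⊆∁T {x} x∈ with x∈p∪q⁻ (X ∪ S) (∁ (X ∪ T)) x∈
    ... | inj₁ x∈X∪S = ∪-⊆-∁ X∩T≡∅ S∩T≡∅ x∈X∪S
    ... | inj₂ x∈∁ = x∉p⇒x∈∁p (λ x∈T → x∈∁p⇒x∉p x∈∁ (q⊆p∪q X T x∈T))
    ∁T⊆ : ∁ T ⊆ (X ∪ S) ∪ ∁ (X ∪ T)
    ∁T⊆ {x} x∈∁T with x ∈? X
    ... | yes x∈X = x∈p∪q⁺ (inj₁ (x∈p∪q⁺ (inj₁ x∈X)))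
    ... | no  x∉X = x∈p∪q⁺ (inj₂ (x∉p⇒x∈∁p (∉-∪ x∉X (x∈∁p⇒x∉p x∈∁T))))

  ∣∪∣+∣∩∣ : (X Y : Subset m) → ∣ X ∪ Y ∣ + ∣ X ∩ Y ∣ ≡ ∣ X ∣ + ∣ Y ∣
  ∣∪∣+∣∩∣ = go
    where
    open import Data.Vec using (_∷_; [])
    go : ∀ {k} (X Y : Subset k) → ∣ X ∪ Y ∣ + ∣ X ∩ Y ∣ ≡ ∣ X ∣ + ∣ Y ∣
    go []            []            = refl
    go (true  ∷ X) (true  ∷ Y) =
      cong suc (trans (+-suc _ _) (trans (cong suc (go X Y)) (sym (+-suc _ _))))
    go (true  ∷ X) (false ∷ Y) = cong suc (go X Y)
    go (false ∷ X) (true  ∷ Y) = trans (cong suc (go X Y)) (sym (+-suc _ _))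
    go (false ∷ X) (false ∷ Y) = go X Y

  ∣∪∣-disjoint : (X Y : Subset m) → Empty (X ∩ Y) → ∣ X ∪ Y ∣ ≡ ∣ X ∣ + ∣ Y ∣
  ∣∪∣-disjoint X Y X∩Y≡∅ = begin
    ∣ X ∪ Y ∣                   ≡⟨ +-identityʳ _ ⟨
    ∣ X ∪ Y ∣ + 0               ≡⟨ cong (∣ X ∪ Y ∣ +_) (∣⊥∣≡0 m) ⟨
    ∣ X ∪ Y ∣ + ∣ ⊥ {m} ∣       ≡⟨ cong (λ Z → ∣ X ∪ Y ∣ + ∣ Z ∣) (Empty-unique X∩Y≡∅) ⟨
    ∣ X ∪ Y ∣ + ∣ X ∩ Y ∣       ≡⟨ ∣∪∣+∣∩∣ X Y ⟩
    ∣ X ∣ + ∣ Y ∣               ∎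
    where open ≡-Reasoning

  ∣X∣+∣∁X∣ : (X : Subset m) → ∣ X ∣ + ∣ ∁ X ∣ ≡ m
  ∣X∣+∣∁X∣ X = trans (cong (∣ X ∣ +_) (∣∁p∣≡n∸∣p∣ X)) (m+[n∸m]≡n (∣p∣≤n X))

  ∣X∣+∣Y∩∁X∣ : {X Y : Subset m} → X ⊆ Y → ∣ X ∣ + ∣ Y ∩ ∁ X ∣ ≡ ∣ Y ∣
  ∣X∣+∣Y∩∁X∣ = go _ _
    where
    open import Data.Vec using (_∷_; []; here)
    go : ∀ {k} (X Y : Subset k) → X ⊆ Y → ∣ X ∣ + ∣ Y ∩ ∁ X ∣ ≡ ∣ Y ∣
    go []          []          _   = refl
    go (true  ∷ X) (true  ∷ Y) X⊆Y = cong suc (go X Y (drop-∷-⊆ X⊆Y))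
    go (true  ∷ X) (false ∷ Y) X⊆Y = contradiction (X⊆Y here) λ ()
    go (false ∷ X) (true  ∷ Y) X⊆Y = trans (+-suc _ _) (cong suc (go X Y (drop-∷-⊆ X⊆Y)))
    go (false ∷ X) (false ∷ Y) X⊆Y = go X Y (drop-∷-⊆ X⊆Y)

  ∁X⊆∁Y∪[Y∩∁X] : (X Y : Subset m) → ∁ X ⊆ ∁ Y ∪ (Y ∩ ∁ X)
  ∁X⊆∁Y∪[Y∩∁X] X Y {x} x∈∁X with x ∈? Y
  ... | yes x∈Y = x∈p∪q⁺ (inj₂ (x∈p∩q⁺ (x∈Y , x∈∁X)))
  ... | no  x∉Y = x∈p∪q⁺ (inj₁ (x∉p⇒x∈∁p x∉Y))

-- Local connectivity and connectivity

module Connectivity {m : ℕ} (M : Matroid m) where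
  open Matroid M

  r-⊥ : r ⊥ ≡ 0
  r-⊥ = n≤0⇒n≡0 (≤-trans (r-bounded ⊥) (≤-reflexive (∣⊥∣≡0 m)))

  r-subadditive : (X Y : Subset m) → r (X ∪ Y) ≤ r X + r Y
  r-subadditive X Y = ≤-trans (m≤m+n (r (X ∪ Y)) (r (X ∩ Y))) (r-submod X Y)

  rM≤r+r∁ : (X : Subset m) → rM M ≤ r X + r (∁ X)
  rM≤r+r∁ X = subst (λ Z → r Z ≤ r X + r (∁ X)) (p∪∁p≡⊤ X) (r-subadditive X (∁ X))

  -- The truncated subtractions defining ⊓, λ' and r* never truncate.
  ⊓-unfold : (X Y : Subset m) → ⊓ M X Y + r (X ∪ Y) ≡ r X + r Y
  ⊓-unfold X Y = m∸n+n≡m (r-subadditive X Y)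

  λ-unfold : (X : Subset m) → λ' M X + rM M ≡ r X + r (∁ X)
  λ-unfold X = m∸n+n≡m (rM≤r+r∁ X)

  r*-unfold : (X : Subset m) → r* M X + rM M ≡ ∣ X ∣ + r (∁ X)
  r*-unfold X = m∸n+n≡m (≤-trans (rM≤r+r∁ X) (+-monoˡ-≤ (r (∁ X)) (r-bounded X)))

  ⊓-comm : (X Y : Subset m) → ⊓ M X Y ≡ ⊓ M Y X
  ⊓-comm X Y = cong₂ _∸_ (+-comm (r X) (r Y)) (cong r (∪-comm X Y))

  ⊓-∁ : (X : Subset m) → ⊓ M X (∁ X) ≡ λ' M X
  ⊓-∁ X = cong (r X + r (∁ X) ∸_) (cong r (p∪∁p≡⊤ X))

  λ-∁ : (X : Subset m) → λ' M (∁ X) ≡ λ' M X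
  λ-∁ X = cong (_∸ rM M)
    (trans (cong (r (∁ X) +_) (cong r (∁-involutive X))) (+-comm (r (∁ X)) (r X)))

  λ-submod : (X Y : Subset m) → λ' M (X ∩ Y) + λ' M (X ∪ Y) ≤ λ' M X + λ' M Y
  λ-submod X Y =
    arith (λ' M (X ∩ Y)) (λ' M (X ∪ Y)) (λ' M X) (λ' M Y) (rM M)
          (r (X ∩ Y)) (r (∁ (X ∩ Y))) (r (X ∪ Y)) (r (∁ (X ∪ Y)))
          (r X) (r (∁ X)) (r Y) (r (∁ Y))
          (λ-unfold (X ∩ Y)) (λ-unfold (X ∪ Y)) (λ-unfold X) (λ-unfold Y)
          (r-submod X Y) submod-∁
    where
    submod-∁ : r (∁ (X ∩ Y)) + r (∁ (X ∪ Y)) ≤ r (∁ X) + r (∁ Y)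
    submod-∁ = subst₂ (λ A B → r A + r B ≤ r (∁ X) + r (∁ Y))
                 (sym (∁-∩ X Y)) (sym (∁-∪ X Y)) (r-submod (∁ X) (∁ Y))
    arith : ∀ a b c d k p p′ q q′ s s′ u u′ →
      a + k ≡ p + p′ → b + k ≡ q + q′ → c + k ≡ s + s′ → d + k ≡ u + u′ →
      q + p ≤ s + u → p′ + q′ ≤ s′ + u′ → a + b ≤ c + d
    arith a b c d k p p′ q q′ s s′ u u′ ea eb ec ed h h′ =
      +-cancelʳ-≤ (k + k) (a + b) (c + d) (begin
        a + b + (k + k)           ≡⟨ solve (a ∷ b ∷ k ∷ []) ⟩
        (a + k) + (b + k)         ≡⟨ cong₂ _+_ ea eb ⟩
        (p + p′) + (q + q′)       ≡⟨ solve (p ∷ p′ ∷ q ∷ q′ ∷ []) ⟩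
        (q + p) + (p′ + q′)       ≤⟨ +-mono-≤ h h′ ⟩
        (s + u) + (s′ + u′)       ≡⟨ solve (s ∷ s′ ∷ u ∷ u′ ∷ []) ⟩
        (s + s′) + (u + u′)       ≡⟨ cong₂ _+_ ec ed ⟨
        (c + k) + (d + k)         ≡⟨ solve (c ∷ d ∷ k ∷ []) ⟩
        c + d + (k + k)           ∎)
      where open ≤-Reasoning

  ⊓-mono : (X : Subset m) {Y Z : Subset m} → Y ⊆ Z → ⊓ M X Y ≤ ⊓ M X Z
  ⊓-mono X {Y} {Z} Y⊆Z =
    arith (⊓ M X Y) (⊓ M X Z) (r (X ∪ Y)) (r (X ∪ Z)) (r X) (r Y) (r Z)
          (⊓-unfold X Y) (⊓-unfold X Z) exchange
    where
    exchange : r (X ∪ Z) + r Y ≤ r (X ∪ Y) + r Z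
    exchange = begin
      r (X ∪ Z) + r Y                 ≡⟨ cong (λ W → r (X ∪ W) + r Y) (p⊆q⇒p∪q≡q Y⊆Z) ⟨
      r (X ∪ (Y ∪ Z)) + r Y           ≡⟨ cong (λ W → r W + r Y) (∪-assoc X Y Z) ⟨
      r ((X ∪ Y) ∪ Z) + r Y           ≤⟨ +-monoʳ-≤ _ (r-monotone Y⊆) ⟩
      r ((X ∪ Y) ∪ Z) + r ((X ∪ Y) ∩ Z) ≤⟨ r-submod (X ∪ Y) Z ⟩
      r (X ∪ Y) + r Z                 ∎
      where
      open ≤-Reasoning
      Y⊆ : Y ⊆ (X ∪ Y) ∩ Z
      Y⊆ y∈Y = x∈p∩q⁺ (q⊆p∪q X Y y∈Y , Y⊆Z y∈Y)
    arith : ∀ a b p q x y z → a + p ≡ x + y → b + q ≡ x + z → q + y ≤ p + z → a ≤ b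
    arith a b p q x y z ea eb h = +-cancelʳ-≤ (p + q) a b (begin
      a + (p + q)         ≡⟨ solve (a ∷ p ∷ q ∷ []) ⟩
      (a + p) + q         ≡⟨ cong (_+ q) ea ⟩
      (x + y) + q         ≡⟨ solve (x ∷ y ∷ q ∷ []) ⟩
      x + (q + y)         ≤⟨ +-monoʳ-≤ x h ⟩
      x + (p + z)         ≡⟨ solve (x ∷ p ∷ z ∷ []) ⟩
      (x + z) + p         ≡⟨ cong (_+ p) eb ⟨
      (b + q) + p         ≡⟨ solve (b ∷ q ∷ p ∷ []) ⟩
      b + (p + q)         ∎)
      where open ≤-Reasoning

  ⊓-monoˡ : {Y Z : Subset m} (X : Subset m) → Y ⊆ Z → ⊓ M Y X ≤ ⊓ M Z X
  ⊓-monoˡ {Y} {Z} X Y⊆Z = subst₂ _≤_ (⊓-comm X Y) (⊓-comm X Z) (⊓-mono X Y⊆Z)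

  ⊓-chain : (X Y Z : Subset m) → ⊓ M X Y + ⊓ M (X ∪ Y) Z ≡ ⊓ M X (Y ∪ Z) + ⊓ M Y Z
  ⊓-chain X Y Z =
    arith (⊓ M X Y) (⊓ M (X ∪ Y) Z) (⊓ M X (Y ∪ Z)) (⊓ M Y Z)
          (r X) (r Y) (r Z) (r (X ∪ Y)) (r (Y ∪ Z)) (r (X ∪ (Y ∪ Z)))
          (⊓-unfold X Y)
          (subst (λ W → ⊓ M (X ∪ Y) Z + r W ≡ r (X ∪ Y) + r Z) (∪-assoc X Y Z) (⊓-unfold (X ∪ Y) Z))
          (⊓-unfold X (Y ∪ Z)) (⊓-unfold Y Z)
    where
    arith : ∀ a b c d x y z xy yz xyz →
      a + xy ≡ x + y → b + xyz ≡ xy + z → c + xyz ≡ x + yz → d + yz ≡ y + z → a + b ≡ c + d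
    arith a b c d x y z xy yz xyz ea eb ec ed = +-cancelʳ-≡ (xy + yz + xyz) (a + b) (c + d) (begin
      a + b + (xy + yz + xyz)         ≡⟨ solve (a ∷ b ∷ xy ∷ yz ∷ xyz ∷ []) ⟩
      (a + xy) + (b + xyz) + yz       ≡⟨ cong₂ (λ u v → u + v + yz) ea eb ⟩
      (x + y) + (xy + z) + yz         ≡⟨ solve (x ∷ y ∷ z ∷ xy ∷ yz ∷ []) ⟩
      (x + yz) + (y + z) + xy         ≡⟨ cong₂ (λ u v → u + v + xy) ec ed ⟨
      (c + xyz) + (d + yz) + xy       ≡⟨ solve (c ∷ d ∷ xy ∷ yz ∷ xyz ∷ []) ⟩
      c + d + (xy + yz + xyz)         ∎)
      where open ≡-Reasoning

  ⊓-≤-λ : (X : Subset m) {Y : Subset m} → Y ⊆ ∁ X → ⊓ M X Y ≤ λ' M X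
  ⊓-≤-λ X {Y} Y⊆∁X = subst (⊓ M X Y ≤_) (⊓-∁ X) (⊓-mono X Y⊆∁X)

  ⊓-shift : (X Y : Subset m) → Empty (X ∩ Y) →
            ⊓ M X Y + λ' M (X ∪ Y) ≡ λ' M X + ⊓ M Y (∁ (X ∪ Y))
  ⊓-shift X Y X∩Y≡∅ = begin
    ⊓ M X Y + λ' M (X ∪ Y)                         ≡⟨ cong (⊓ M X Y +_) (⊓-∁ (X ∪ Y)) ⟨
    ⊓ M X Y + ⊓ M (X ∪ Y) (∁ (X ∪ Y))              ≡⟨ ⊓-chain X Y (∁ (X ∪ Y)) ⟩
    ⊓ M X (Y ∪ ∁ (X ∪ Y)) + ⊓ M Y (∁ (X ∪ Y))
      ≡⟨ cong (λ W → ⊓ M X W + ⊓ M Y (∁ (X ∪ Y))) (∪-∁-∪ X Y X∩Y≡∅) ⟩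
    ⊓ M X (∁ X) + ⊓ M Y (∁ (X ∪ Y))                ≡⟨ cong (_+ ⊓ M Y (∁ (X ∪ Y))) (⊓-∁ X) ⟩
    λ' M X + ⊓ M Y (∁ (X ∪ Y))                     ∎
    where open ≡-Reasoning

  ⊓-outside : (X Y : Subset m) {Z : Subset m} → Empty (X ∩ Y) → Z ⊆ ∁ (X ∪ Y) →
              λ' M X + ⊓ M Y Z ≤ ⊓ M X Y + λ' M (X ∪ Y)
  ⊓-outside X Y {Z} X∩Y≡∅ Z⊆ = begin
    λ' M X + ⊓ M Y Z                 ≤⟨ +-monoʳ-≤ (λ' M X) (⊓-mono Y Z⊆) ⟩
    λ' M X + ⊓ M Y (∁ (X ∪ Y))       ≡⟨ ⊓-shift X Y X∩Y≡∅ ⟨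
    ⊓ M X Y + λ' M (X ∪ Y)           ∎
    where open ≤-Reasoning

  ⊓-outside-≤ : (X Y : Subset m) {Z : Subset m} → Empty (X ∩ Y) → Z ⊆ ∁ (X ∪ Y) →
                λ' M (X ∪ Y) ≤ λ' M X → ⊓ M Y Z ≤ ⊓ M X Y
  ⊓-outside-≤ X Y {Z} X∩Y≡∅ Z⊆ λ-drop = +-cancelˡ-≤ (λ' M X) (⊓ M Y Z) (⊓ M X Y) (begin
    λ' M X + ⊓ M Y Z              ≤⟨ ⊓-outside X Y X∩Y≡∅ Z⊆ ⟩
    ⊓ M X Y + λ' M (X ∪ Y)        ≤⟨ +-monoʳ-≤ (⊓ M X Y) λ-drop ⟩
    ⊓ M X Y + λ' M X              ≡⟨ +-comm (⊓ M X Y) (λ' M X) ⟩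
    λ' M X + ⊓ M X Y              ∎)
    where open ≤-Reasoning

  ⊓-triangle : (X Y Z : Subset m) → X ∪ Y ⊆ ∁ Z → ⊓ M X Z + ⊓ M Y Z ≤ ⊓ M X Y + λ' M Z
  ⊓-triangle X Y Z X∪Y⊆∁Z = begin
    ⊓ M X Z + ⊓ M Y Z                ≤⟨ +-monoˡ-≤ (⊓ M Y Z) (⊓-mono X (q⊆p∪q Y Z)) ⟩
    ⊓ M X (Y ∪ Z) + ⊓ M Y Z          ≡⟨ ⊓-chain X Y Z ⟨
    ⊓ M X Y + ⊓ M (X ∪ Y) Z
      ≤⟨ +-monoʳ-≤ (⊓ M X Y) (subst (_≤ λ' M Z) (⊓-comm Z (X ∪ Y)) (⊓-≤-λ Z X∪Y⊆∁Z)) ⟩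
    ⊓ M X Y + λ' M Z                 ∎
    where open ≤-Reasoning

  ⊓+⊓-≤ : (X A B Y : Subset m) → Empty (Y ∩ X) → A ∪ B ⊆ ∁ (Y ∪ X) →
          ⊓ M X A + ⊓ M X B + λ' M Y ≤ ⊓ M Y X + λ' M (Y ∪ X) + ⊓ M A B
  ⊓+⊓-≤ X A B Y Y∩X≡∅ A∪B⊆ = begin
    ⊓ M X A + ⊓ M X B + λ' M Y
      ≤⟨ +-monoˡ-≤ (λ' M Y) (+-monoʳ-≤ (⊓ M X A) (⊓-monoˡ B (p⊆p∪q A))) ⟩
    ⊓ M X A + ⊓ M (X ∪ A) B + λ' M Y
      ≡⟨ cong (_+ λ' M Y) (⊓-chain X A B) ⟩
    ⊓ M X (A ∪ B) + ⊓ M A B + λ' M Y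
      ≤⟨ +-monoˡ-≤ (λ' M Y) (+-monoˡ-≤ (⊓ M A B) (⊓-mono X A∪B⊆)) ⟩
    ⊓ M X (∁ (Y ∪ X)) + ⊓ M A B + λ' M Y
      ≡⟨ xy∙z≈zx∙y (⊓ M X (∁ (Y ∪ X))) (⊓ M A B) (λ' M Y) ⟩
    λ' M Y + ⊓ M X (∁ (Y ∪ X)) + ⊓ M A B
      ≡⟨ cong (_+ ⊓ M A B) (⊓-shift Y X Y∩X≡∅) ⟨
    ⊓ M Y X + λ' M (Y ∪ X) + ⊓ M A B              ∎
    where open ≤-Reasoning

  λ-∪-∪ : (X A B : Subset m) → Empty (A ∩ B) →
          λ' M X + λ' M (X ∪ (A ∪ B)) ≤ λ' M (X ∪ A) + λ' M (X ∪ B)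
  λ-∪-∪ X A B A∩B≡∅ =
    subst₂ (λ U V → λ' M U + λ' M V ≤ λ' M (X ∪ A) + λ' M (X ∪ B))
      (∪-∩-∪ X A B A∩B≡∅) (∪-∪-∪ X A B) (λ-submod (X ∪ A) (X ∪ B))

  λ+λ-≤ : (X S T : Subset m) → Empty (X ∩ S) → Empty (X ∩ T) → Empty (S ∩ T) →
          λ' M S + λ' M T ≤ λ' M (X ∪ S) + λ' M (X ∪ T)
  λ+λ-≤ X S T X∩S≡∅ X∩T≡∅ S∩T≡∅ = begin
    λ' M S + λ' M T
      ≡⟨ cong₂ _+_ (cong (λ' M) (∪-∩-∁-∪ X S T X∩S≡∅ S∩T≡∅))
                   (trans (cong (λ' M) (∪-∪-∁-∪ X S T X∩T≡∅ S∩T≡∅)) (λ-∁ T)) ⟨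
    λ' M ((X ∪ S) ∩ ∁ (X ∪ T)) + λ' M ((X ∪ S) ∪ ∁ (X ∪ T))
      ≤⟨ λ-submod (X ∪ S) (∁ (X ∪ T)) ⟩
    λ' M (X ∪ S) + λ' M (∁ (X ∪ T))
      ≡⟨ cong (λ' M (X ∪ S) +_) (λ-∁ (X ∪ T)) ⟩
    λ' M (X ∪ S) + λ' M (X ∪ T) ∎
    where open ≤-Reasoning

-- The dual matroid

module _ {m : ℕ} (M : Matroid m) where
  open Matroid M
  open Connectivity M

  r*-bounded : (X : Subset m) → r* M X ≤ ∣ X ∣
  r*-bounded X = +-cancelʳ-≤ (rM M) (r* M X) ∣ X ∣ (begin
    r* M X + rM M      ≡⟨ r*-unfold X ⟩
    ∣ X ∣ + r (∁ X)    ≤⟨ +-monoʳ-≤ ∣ X ∣ (r-monotone ⊆⊤) ⟩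
    ∣ X ∣ + rM M       ∎)
    where open ≤-Reasoning

  r*-monotone : {X Y : Subset m} → X ⊆ Y → r* M X ≤ r* M Y
  r*-monotone {X} {Y} X⊆Y = +-cancelʳ-≤ (rM M) (r* M X) (r* M Y) (begin
    r* M X + rM M                        ≡⟨ r*-unfold X ⟩
    ∣ X ∣ + r (∁ X)                      ≤⟨ +-monoʳ-≤ (∣ X ∣) r∁X≤ ⟩
    ∣ X ∣ + (r (∁ Y) + ∣ Y ∩ ∁ X ∣)      ≡⟨ x∙yz≈xz∙y (∣ X ∣) (r (∁ Y)) (∣ Y ∩ ∁ X ∣) ⟩
    ∣ X ∣ + ∣ Y ∩ ∁ X ∣ + r (∁ Y)        ≡⟨ cong (_+ r (∁ Y)) (∣X∣+∣Y∩∁X∣ X⊆Y) ⟩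
    ∣ Y ∣ + r (∁ Y)                      ≡⟨ r*-unfold Y ⟨
    r* M Y + rM M                        ∎)
    where
    open ≤-Reasoning
    r∁X≤ : r (∁ X) ≤ r (∁ Y) + ∣ Y ∩ ∁ X ∣
    r∁X≤ = begin
      r (∁ X)                     ≤⟨ r-monotone (∁X⊆∁Y∪[Y∩∁X] X Y) ⟩
      r (∁ Y ∪ (Y ∩ ∁ X))         ≤⟨ r-subadditive (∁ Y) (Y ∩ ∁ X) ⟩
      r (∁ Y) + r (Y ∩ ∁ X)       ≤⟨ +-monoʳ-≤ (r (∁ Y)) (r-bounded (Y ∩ ∁ X)) ⟩
      r (∁ Y) + ∣ Y ∩ ∁ X ∣       ∎

  r*-submod : (X Y : Subset m) → r* M (X ∪ Y) + r* M (X ∩ Y) ≤ r* M X + r* M Y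
  r*-submod X Y =
    arith (r* M (X ∪ Y)) (r* M (X ∩ Y)) (r* M X) (r* M Y) (rM M)
          (∣ X ∪ Y ∣) (∣ X ∩ Y ∣) (∣ X ∣) (∣ Y ∣)
          (r (∁ (X ∪ Y))) (r (∁ (X ∩ Y))) (r (∁ X)) (r (∁ Y))
          (r*-unfold (X ∪ Y)) (r*-unfold (X ∩ Y)) (r*-unfold X) (r*-unfold Y)
          (∣∪∣+∣∩∣ X Y) submod-∁
    where
    submod-∁ : r (∁ (X ∪ Y)) + r (∁ (X ∩ Y)) ≤ r (∁ X) + r (∁ Y)
    submod-∁ = begin
      r (∁ (X ∪ Y)) + r (∁ (X ∩ Y))    ≡⟨ cong₂ (λ A B → r A + r B) (∁-∪ X Y) (∁-∩ X Y) ⟩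
      r (∁ X ∩ ∁ Y) + r (∁ X ∪ ∁ Y)    ≡⟨ +-comm (r (∁ X ∩ ∁ Y)) (r (∁ X ∪ ∁ Y)) ⟩
      r (∁ X ∪ ∁ Y) + r (∁ X ∩ ∁ Y)    ≤⟨ r-submod (∁ X) (∁ Y) ⟩
      r (∁ X) + r (∁ Y)                ∎
      where open ≤-Reasoning
    arith : ∀ s∪ s∩ sX sY k n∪ n∩ nX nY c∪ c∩ cX cY →
      s∪ + k ≡ n∪ + c∪ → s∩ + k ≡ n∩ + c∩ → sX + k ≡ nX + cX → sY + k ≡ nY + cY →
      n∪ + n∩ ≡ nX + nY → c∪ + c∩ ≤ cX + cY → s∪ + s∩ ≤ sX + sY
    arith s∪ s∩ sX sY k n∪ n∩ nX nY c∪ c∩ cX cY e∪ e∩ eX eY en h =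
      +-cancelʳ-≤ (k + k) (s∪ + s∩) (sX + sY) (begin
        s∪ + s∩ + (k + k)           ≡⟨ solve (s∪ ∷ s∩ ∷ k ∷ []) ⟩
        (s∪ + k) + (s∩ + k)         ≡⟨ cong₂ _+_ e∪ e∩ ⟩
        (n∪ + c∪) + (n∩ + c∩)       ≡⟨ solve (n∪ ∷ c∪ ∷ n∩ ∷ c∩ ∷ []) ⟩
        (n∪ + n∩) + (c∪ + c∩)       ≤⟨ +-mono-≤ (≤-reflexive en) h ⟩
        (nX + nY) + (cX + cY)       ≡⟨ solve (nX ∷ nY ∷ cX ∷ cY ∷ []) ⟩
        (nX + cX) + (nY + cY)       ≡⟨ cong₂ _+_ eX eY ⟨
        (sX + k) + (sY + k)         ≡⟨ solve (sX ∷ sY ∷ k ∷ []) ⟩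
        sX + sY + (k + k)           ∎)
      where open ≤-Reasoning

infix 10 _*

-- ⊓ (M *) is ⊓* M by definition, so the lemmas about ⊓ in M * are lemmas about ⊓* in M.
_* : {m : ℕ} → Matroid m → Matroid m
M * = record
  { r          = r* M
  ; r-bounded  = r*-bounded M
  ; r-monotone = r*-monotone M
  ; r-submod   = r*-submod M
  }

module Duality {m : ℕ} (M : Matroid m) where
  open Matroid M
  open Connectivity M
  private module DualConnectivity = Connectivity (M *)

  r*-⊤ : r* M ⊤ + rM M ≡ m
  r*-⊤ = begin
    r* M ⊤ + rM M      ≡⟨ r*-unfold ⊤ ⟩
    ∣ ⊤ {m} ∣ + r (∁ ⊤)  ≡⟨ cong₂ _+_ (∣⊤∣≡n m) (trans (cong r ∁-⊤) r-⊥) ⟩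
    m + 0              ≡⟨ +-identityʳ m ⟩
    m                  ∎
    where open ≡-Reasoning

  r*-unfold-∁ : (X : Subset m) → r* M (∁ X) + rM M ≡ ∣ ∁ X ∣ + r X
  r*-unfold-∁ X = trans (r*-unfold (∁ X)) (cong (λ Y → ∣ ∁ X ∣ + r Y) (∁-involutive X))

  λ-dual : (X : Subset m) → λ' (M *) X ≡ λ' M X
  λ-dual X =
    arith (λ' (M *) X) (r* M ⊤) (r* M X) (r* M (∁ X)) (rM M)
          (∣ X ∣) (∣ ∁ X ∣) (r (∁ X)) (r X) (λ' M X)
          (DualConnectivity.λ-unfold X) r*-⊤ (r*-unfold X) (r*-unfold-∁ X) (∣X∣+∣∁X∣ X) (λ-unfold X)
    where
    arith : ∀ l* s⊤ sX s∁ k nX n∁ cX rX l →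
      l* + s⊤ ≡ sX + s∁ → s⊤ + k ≡ m → sX + k ≡ nX + cX → s∁ + k ≡ n∁ + rX →
      nX + n∁ ≡ m → l + k ≡ rX + cX → l* ≡ l
    arith l* s⊤ sX s∁ k nX n∁ cX rX l e* e⊤ eX e∁ en e =
      +-cancelʳ-≡ (s⊤ + k + k) l* l (begin
        l* + (s⊤ + k + k)           ≡⟨ solve (l* ∷ s⊤ ∷ k ∷ []) ⟩
        (l* + s⊤) + k + k           ≡⟨ cong (λ u → u + k + k) e* ⟩
        (sX + s∁) + k + k           ≡⟨ solve (sX ∷ s∁ ∷ k ∷ []) ⟩
        (sX + k) + (s∁ + k)         ≡⟨ cong₂ _+_ eX e∁ ⟩
        (nX + cX) + (n∁ + rX)       ≡⟨ solve (nX ∷ cX ∷ n∁ ∷ rX ∷ []) ⟩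
        (nX + n∁) + (rX + cX)       ≡⟨ cong₂ _+_ (trans e⊤ (sym en)) e ⟨
        (s⊤ + k) + (l + k)          ≡⟨ solve (s⊤ ∷ k ∷ l ∷ []) ⟩
        l + (s⊤ + k + k)            ∎)
      where open ≡-Reasoning

  r**≡r : (X : Subset m) → r* (M *) X ≡ r X
  r**≡r X =
    arith (r* (M *) X) (r* M ⊤) (∣ X ∣) (r* M (∁ X)) (rM M) (∣ ∁ X ∣) (r X)
          (DualConnectivity.r*-unfold X) (r*-unfold-∁ X) r*-⊤ (∣X∣+∣∁X∣ X)
    where
    arith : ∀ t s⊤ nX s∁ k n∁ rX →
      t + s⊤ ≡ nX + s∁ → s∁ + k ≡ n∁ + rX → s⊤ + k ≡ m → nX + n∁ ≡ m → t ≡ rX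
    arith t s⊤ nX s∁ k n∁ rX et e∁ e⊤ en = +-cancelʳ-≡ (s⊤ + k) t rX (begin
      t + (s⊤ + k)          ≡⟨ solve (t ∷ s⊤ ∷ k ∷ []) ⟩
      (t + s⊤) + k          ≡⟨ cong (_+ k) et ⟩
      (nX + s∁) + k         ≡⟨ solve (nX ∷ s∁ ∷ k ∷ []) ⟩
      nX + (s∁ + k)         ≡⟨ cong (nX +_) e∁ ⟩
      nX + (n∁ + rX)        ≡⟨ solve (nX ∷ n∁ ∷ rX ∷ []) ⟩
      (nX + n∁) + rX        ≡⟨ cong (_+ rX) (trans en (sym e⊤)) ⟩
      (s⊤ + k) + rX         ≡⟨ +-comm (s⊤ + k) rX ⟩
      rX + (s⊤ + k)         ∎)
      where open ≡-Reasoning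

  ⊓*-dual : (X Y : Subset m) → ⊓* (M *) X Y ≡ ⊓ M X Y
  ⊓*-dual X Y = cong₂ _∸_ (cong₂ _+_ (r**≡r X) (r**≡r Y)) (r**≡r (X ∪ Y))

  ⊓*-unfold : (X Y : Subset m) → Empty (X ∩ Y) →
              ⊓* M X Y + (r (∁ (X ∪ Y)) + rM M) ≡ r (∁ X) + r (∁ Y)
  ⊓*-unfold X Y X∩Y≡∅ =
    arith (⊓* M X Y) (r* M (X ∪ Y)) (r* M X) (r* M Y) (rM M) (∣ X ∣) (∣ Y ∣)
           (r (∁ (X ∪ Y))) (r (∁ X)) (r (∁ Y))
           (DualConnectivity.⊓-unfold X Y)
           (trans (r*-unfold (X ∪ Y)) (cong (_+ r (∁ (X ∪ Y))) (∣∪∣-disjoint X Y X∩Y≡∅)))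
           (r*-unfold X) (r*-unfold Y)
    where
    arith : ∀ b sXY sX sY k nX nY cXY cX cY →
      b + sXY ≡ sX + sY → sXY + k ≡ (nX + nY) + cXY → sX + k ≡ nX + cX → sY + k ≡ nY + cY →
      b + (cXY + k) ≡ cX + cY
    arith b sXY sX sY k nX nY cXY cX cY eb eXY eX eY =
      +-cancelʳ-≡ (nX + nY) (b + (cXY + k)) (cX + cY) (begin
        b + (cXY + k) + (nX + nY)        ≡⟨ solve (b ∷ cXY ∷ k ∷ nX ∷ nY ∷ []) ⟩
        b + ((nX + nY) + cXY) + k        ≡⟨ cong (λ u → b + u + k) eXY ⟨
        b + (sXY + k) + k                ≡⟨ solve (b ∷ sXY ∷ k ∷ []) ⟩
        (b + sXY) + k + k                ≡⟨ cong (λ u → u + k + k) eb ⟩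
        (sX + sY) + k + k                ≡⟨ solve (sX ∷ sY ∷ k ∷ []) ⟩
        (sX + k) + (sY + k)              ≡⟨ cong₂ _+_ eX eY ⟩
        (nX + cX) + (nY + cY)            ≡⟨ solve (nX ∷ cX ∷ nY ∷ cY ∷ []) ⟩
        cX + cY + (nX + nY)              ∎)
      where open ≡-Reasoning

  ⊓+⊓* : (X Y : Subset m) → Empty (X ∩ Y) →
         ⊓ M X Y + ⊓* M X Y + λ' M (X ∪ Y) ≡ λ' M X + λ' M Y
  ⊓+⊓* X Y X∩Y≡∅ =
    arith (⊓ M X Y) (⊓* M X Y) (λ' M (X ∪ Y)) (λ' M X) (λ' M Y) (rM M)
          (r X) (r Y) (r (X ∪ Y)) (r (∁ X)) (r (∁ Y)) (r (∁ (X ∪ Y)))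
          (⊓-unfold X Y) (⊓*-unfold X Y X∩Y≡∅) (λ-unfold (X ∪ Y)) (λ-unfold X) (λ-unfold Y)
    where
    arith : ∀ a b l lX lY k rX rY rXY cX cY cXY →
      a + rXY ≡ rX + rY → b + (cXY + k) ≡ cX + cY → l + k ≡ rXY + cXY →
      lX + k ≡ rX + cX → lY + k ≡ rY + cY → a + b + l ≡ lX + lY
    arith a b l lX lY k rX rY rXY cX cY cXY ea eb el eX eY =
      +-cancelʳ-≡ (rXY + cXY + k + k) (a + b + l) (lX + lY) (begin
        a + b + l + (rXY + cXY + k + k)       ≡⟨ solve (a ∷ b ∷ l ∷ rXY ∷ cXY ∷ k ∷ []) ⟩
        (a + rXY) + (b + (cXY + k)) + (l + k) ≡⟨ cong₂ _+_ (cong₂ _+_ ea eb) el ⟩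
        (rX + rY) + (cX + cY) + (rXY + cXY)   ≡⟨ solve (rX ∷ rY ∷ cX ∷ cY ∷ rXY ∷ cXY ∷ []) ⟩
        (rX + cX) + (rY + cY) + (rXY + cXY)   ≡⟨ cong (λ u → u + (rXY + cXY)) (cong₂ _+_ eX eY) ⟨
        (lX + k) + (lY + k) + (rXY + cXY)     ≡⟨ solve (lX ∷ lY ∷ k ∷ rXY ∷ cXY ∷ []) ⟩
        lX + lY + (rXY + cXY + k + k)         ∎)
      where open ≡-Reasoning

-- Consequences of being a (4,2)-flexipath

record FlexipathFacts {m : ℕ} (M : Matroid m) (n : ℕ)
                 (L : Subset m) (Q : Fin n → Subset m) (R : Subset m) : Set where
  field
    L∩R≡∅   : Empty (L ∩ R)
    L∩Q≡∅   : ∀ i → Empty (L ∩ Q i)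
    Q∩R≡∅   : ∀ i → Empty (Q i ∩ R)
    Q∩Q≡∅   : ∀ i j → i ≢ j → Empty (Q i ∩ Q j)
    covers  : ∀ x → x ∈ L ⊎ (∃[ i ] x ∈ Q i) ⊎ x ∈ R
    λL≡3    : λ' M L ≡ 3
    λL∪Q≡3  : ∀ i → λ' M (L ∪ Q i) ≡ 3
    λR∪Q≤3  : ∀ i → λ' M (R ∪ Q i) ≤ 3
    κ≥3     : ∀ Z → L ⊆ Z → Z ⊆ ∁ R → 3 ≤ λ' M Z
    λQ≡2    : ∀ i → λ' M (Q i) ≡ 2
    λQ∪Q≥3  : ∀ i j → i ≢ j → 3 ≤ λ' M (Q i ∪ Q j)

dual-facts : ∀ {m} {M : Matroid m} {n L Q R} →
             FlexipathFacts M n L Q R → FlexipathFacts (M *) n L Q R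
dual-facts {M = M} F = record
  { L∩R≡∅  = L∩R≡∅
  ; L∩Q≡∅  = L∩Q≡∅
  ; Q∩R≡∅  = Q∩R≡∅
  ; Q∩Q≡∅  = Q∩Q≡∅
  ; covers = covers
  ; λL≡3   = trans (λ-dual _) λL≡3
  ; λL∪Q≡3 = λ i → trans (λ-dual _) (λL∪Q≡3 i)
  ; λR∪Q≤3 = λ i → subst (_≤ 3) (sym (λ-dual _)) (λR∪Q≤3 i)
  ; κ≥3    = λ Z L⊆Z Z⊆∁R → subst (3 ≤_) (sym (λ-dual Z)) (κ≥3 Z L⊆Z Z⊆∁R)
  ; λQ≡2   = λ i → trans (λ-dual _) (λQ≡2 i)
  ; λQ∪Q≥3 = λ i j i≢j → subst (3 ≤_) (sym (λ-dual _)) (λQ∪Q≥3 i j i≢j)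
  }
  where open FlexipathFacts F
        open Duality M using (λ-dual)

-- SpeciallyPlaced M L Q R i unfolds to SpecialIn M L Q R i ⊎ SpecialIn (M *) L Q R i.
SpecialIn : ∀ {m} (M : Matroid m) {n} → Subset m → (Fin n → Subset m) → Subset m → Fin n → Set
SpecialIn M L Q R i = ⊓ M L R ≡ 2 × ⊓ M L (Q i) ≡ 2 × ⊓ M R (Q i) ≡ 2

module FlexipathLemmas {m : ℕ} {M : Matroid m} {n : ℕ} {L : Subset m} {Q : Fin n → Subset m}
                  {R : Subset m} (F : FlexipathFacts M n L Q R) where
  open FlexipathFacts F
  open Connectivity M
  open Duality M using (⊓+⊓*)
  private module DualConnectivity = Connectivity (M *)

  λR≥3 : 3 ≤ λ' M R
  λR≥3 = subst (3 ≤_) (λ-∁ R) (κ≥3 (∁ R) (⊆-∁-of-disjoint (disjoint-sym L∩R≡∅)) ⊆-refl)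

  ⊓+⊓*-L-Q : ∀ i → ⊓ M L (Q i) + ⊓* M L (Q i) ≡ 2
  ⊓+⊓*-L-Q i = +-cancelʳ-≡ 3 (⊓ M L (Q i) + ⊓* M L (Q i)) 2 (begin
    ⊓ M L (Q i) + ⊓* M L (Q i) + 3
      ≡⟨ cong (⊓ M L (Q i) + ⊓* M L (Q i) +_) (λL∪Q≡3 i) ⟨
    ⊓ M L (Q i) + ⊓* M L (Q i) + λ' M (L ∪ Q i)     ≡⟨ ⊓+⊓* L (Q i) (L∩Q≡∅ i) ⟩
    λ' M L + λ' M (Q i)                             ≡⟨ cong₂ _+_ λL≡3 (λQ≡2 i) ⟩
    5                                               ∎)
    where open ≡-Reasoning

  ⊓-L-Q≤2 : ∀ i → ⊓ M L (Q i) ≤ 2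
  ⊓-L-Q≤2 i = subst (⊓ M L (Q i) ≤_) (⊓+⊓*-L-Q i) (m≤m+n _ _)

  ⊓-R-Q≡⊓-L-Q : ∀ i → ⊓ M R (Q i) ≡ ⊓ M L (Q i)
  ⊓-R-Q≡⊓-L-Q i = ≤-antisym
    (subst (_≤ ⊓ M L (Q i)) (⊓-comm (Q i) R)
      (⊓-outside-≤ L (Q i) (L∩Q≡∅ i) (⊆-∁-∪ L∩R≡∅ (Q∩R≡∅ i))
        (≤-reflexive (trans (λL∪Q≡3 i) (sym λL≡3)))))
    (subst (_≤ ⊓ M R (Q i)) (⊓-comm (Q i) L)
      (⊓-outside-≤ R (Q i) (disjoint-sym (Q∩R≡∅ i))
        (⊆-∁-∪ (disjoint-sym L∩R≡∅) (disjoint-sym (L∩Q≡∅ i)))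
        (≤-trans (λR∪Q≤3 i) λR≥3)))

  ⊓-L-R≥2 : ∀ i → ⊓ M L (Q i) ≡ 2 → 2 ≤ ⊓ M L R
  ⊓-L-R≥2 i α≡2 = +-cancelʳ-≤ 2 2 (⊓ M L R) (begin
    4                                   ≡⟨ cong₂ _+_ α≡2 (trans (⊓-R-Q≡⊓-L-Q i) α≡2) ⟨
    ⊓ M L (Q i) + ⊓ M R (Q i)
      ≤⟨ ⊓-triangle L R (Q i) (∪-⊆-∁ (L∩Q≡∅ i) (disjoint-sym (Q∩R≡∅ i))) ⟩
    ⊓ M L R + λ' M (Q i)                ≡⟨ cong (⊓ M L R +_) (λQ≡2 i) ⟩
    ⊓ M L R + 2                         ∎)
    where open ≤-Reasoning

  ⊓-L-R≤ : ∀ i → ⊓ M L R ≤ suc (⊓ M L (Q i))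
  ⊓-L-R≤ i = +-cancelˡ-≤ 2 (⊓ M L R) (suc (⊓ M L (Q i))) (begin
    2 + ⊓ M L R                          ≡⟨ cong (_+ ⊓ M L R) (λQ≡2 i) ⟨
    λ' M (Q i) + ⊓ M L R
      ≤⟨ ⊓-outside (Q i) L (disjoint-sym (L∩Q≡∅ i)) (⊆-∁-∪ (Q∩R≡∅ i) L∩R≡∅) ⟩
    ⊓ M (Q i) L + λ' M (Q i ∪ L)
      ≡⟨ cong₂ _+_ (⊓-comm (Q i) L) (trans (cong (λ' M) (∪-comm (Q i) L)) (λL∪Q≡3 i)) ⟩
    ⊓ M L (Q i) + 3                      ≡⟨ +-comm (⊓ M L (Q i)) 3 ⟩
    2 + suc (⊓ M L (Q i))                ∎)
    where open ≤-Reasoning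

  special : ∀ {i j} → ⊓ M L (Q i) ≡ 2 → ⊓ M L (Q j) ≡ 1 → SpecialIn M L Q R i
  special {i} {j} α≡2 α′≡1 =
    ≤-antisym (subst (λ a → ⊓ M L R ≤ suc a) α′≡1 (⊓-L-R≤ j)) (⊓-L-R≥2 i α≡2) ,
    α≡2 , trans (⊓-R-Q≡⊓-L-Q i) α≡2

  ⊓-Q-Q≤⊓-L-Q : ∀ {i j} → i ≢ j → ⊓ M (Q i) (Q j) ≤ ⊓ M L (Q i)
  ⊓-Q-Q≤⊓-L-Q {i} {j} i≢j =
    ⊓-outside-≤ L (Q i) (L∩Q≡∅ i) (⊆-∁-∪ (L∩Q≡∅ j) (Q∩Q≡∅ i j i≢j))
      (≤-reflexive (trans (λL∪Q≡3 i) (sym λL≡3)))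

  ⊓+⊓*-Q-Q≤1 : ∀ {i j} → i ≢ j → ⊓ M (Q i) (Q j) + ⊓* M (Q i) (Q j) ≤ 1
  ⊓+⊓*-Q-Q≤1 {i} {j} i≢j = +-cancelʳ-≤ 3 s 1 (begin
    s + 3                          ≤⟨ +-monoʳ-≤ s (λQ∪Q≥3 i j i≢j) ⟩
    s + λ' M (Q i ∪ Q j)           ≡⟨ ⊓+⊓* (Q i) (Q j) (Q∩Q≡∅ i j i≢j) ⟩
    λ' M (Q i) + λ' M (Q j)        ≡⟨ cong₂ _+_ (λQ≡2 i) (λQ≡2 j) ⟩
    4                              ∎)
    where
    open ≤-Reasoning
    s = ⊓ M (Q i) (Q j) + ⊓* M (Q i) (Q j)

  λ-L∪Q∪Q≤3 : ∀ {i j} → i ≢ j → λ' M (L ∪ (Q i ∪ Q j)) ≤ 3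
  λ-L∪Q∪Q≤3 {i} {j} i≢j = +-cancelˡ-≤ 3 (λ' M (L ∪ (Q i ∪ Q j))) 3 (begin
    3 + λ' M (L ∪ (Q i ∪ Q j))           ≡⟨ cong (_+ λ' M (L ∪ (Q i ∪ Q j))) λL≡3 ⟨
    λ' M L + λ' M (L ∪ (Q i ∪ Q j))      ≤⟨ λ-∪-∪ L (Q i) (Q j) (Q∩Q≡∅ i j i≢j) ⟩
    λ' M (L ∪ Q i) + λ' M (L ∪ Q j)      ≡⟨ cong₂ _+_ (λL∪Q≡3 i) (λL∪Q≡3 j) ⟩
    3 + 3                                ∎)
    where open ≤-Reasoning

  L∩Q∪Q≡∅ : ∀ {i j} → Empty (L ∩ (Q i ∪ Q j))
  L∩Q∪Q≡∅ {i} {j} = disjoint-sym (disjoint-∪ (disjoint-sym (L∩Q≡∅ i)) (disjoint-sym (L∩Q≡∅ j)))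

  ⊓+⊓*-L-Q∪Q≥3 : ∀ {i j} → i ≢ j → 3 ≤ ⊓ M L (Q i ∪ Q j) + ⊓* M L (Q i ∪ Q j)
  ⊓+⊓*-L-Q∪Q≥3 {i} {j} i≢j = +-cancelˡ-≤ 3 3 _ (begin
    3 + 3                                        ≤⟨ +-monoʳ-≤ 3 (λQ∪Q≥3 i j i≢j) ⟩
    3 + λ' M (Q i ∪ Q j)                         ≡⟨ cong (_+ λ' M (Q i ∪ Q j)) λL≡3 ⟨
    λ' M L + λ' M (Q i ∪ Q j)                    ≡⟨ ⊓+⊓* L (Q i ∪ Q j) L∩Q∪Q≡∅ ⟨
    ⊓ M L (Q i ∪ Q j) + ⊓* M L (Q i ∪ Q j) + λ' M (L ∪ (Q i ∪ Q j))
                                                 ≤⟨ +-monoʳ-≤ _ (λ-L∪Q∪Q≤3 i≢j) ⟩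
    ⊓ M L (Q i ∪ Q j) + ⊓* M L (Q i ∪ Q j) + 3   ≡⟨ +-comm _ 3 ⟩
    3 + (⊓ M L (Q i ∪ Q j) + ⊓* M L (Q i ∪ Q j)) ∎)
    where open ≤-Reasoning

  -- ⊓(L ∪ Q i, Q j) + ⊓*(L ∪ Q i, Q j) ≤ λ(Q j), and the chain rule moves Q i across
  ⊓-L-Q∪Q≤ : ∀ {i j} → i ≢ j →
             ⊓ M L (Q i ∪ Q j) + ⊓ M (Q i) (Q j) + ⊓* M L (Q j) ≤ ⊓ M L (Q i) + 2
  ⊓-L-Q∪Q≤ {i} {j} i≢j = begin
    ⊓ M L (Q i ∪ Q j) + ⊓ M (Q i) (Q j) + ⊓* M L (Q j)
      ≤⟨ +-monoʳ-≤ _ (DualConnectivity.⊓-monoˡ (Q j) (p⊆p∪q (Q i))) ⟩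
    ⊓ M L (Q i ∪ Q j) + ⊓ M (Q i) (Q j) + u*
      ≡⟨ cong (_+ u*) (⊓-chain L (Q i) (Q j)) ⟨
    ⊓ M L (Q i) + u + u*
      ≡⟨ +-assoc (⊓ M L (Q i)) u u* ⟩
    ⊓ M L (Q i) + (u + u*)
      ≤⟨ +-monoʳ-≤ (⊓ M L (Q i)) u+u*≤2 ⟩
    ⊓ M L (Q i) + 2 ∎
    where
    open ≤-Reasoning
    u  = ⊓ M (L ∪ Q i) (Q j)
    u* = ⊓* M (L ∪ Q i) (Q j)
    L⊆ : L ⊆ (L ∪ Q i) ∪ Q j
    L⊆ x∈L = p⊆p∪q (Q j) (p⊆p∪q (Q i) x∈L)
    ⊆∁R : (L ∪ Q i) ∪ Q j ⊆ ∁ R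
    ⊆∁R = ∪-⊆-∁ (disjoint-∪ L∩R≡∅ (Q∩R≡∅ i)) (Q∩R≡∅ j)
    u+u*≤2 : u + u* ≤ 2
    u+u*≤2 = +-cancelʳ-≤ 3 (u + u*) 2 (begin
      u + u* + 3                          ≤⟨ +-monoʳ-≤ (u + u*) (κ≥3 _ L⊆ ⊆∁R) ⟩
      u + u* + λ' M ((L ∪ Q i) ∪ Q j)
        ≡⟨ ⊓+⊓* (L ∪ Q i) (Q j) (disjoint-∪ (L∩Q≡∅ j) (Q∩Q≡∅ i j i≢j)) ⟩
      λ' M (L ∪ Q i) + λ' M (Q j)         ≡⟨ cong₂ _+_ (λL∪Q≡3 i) (λQ≡2 j) ⟩
      5                                   ∎)

  ⊓+⊓*-L-triple≤ : ∀ {a b c} → a ≢ b → a ≢ c → b ≢ c → let S = Q a ∪ (Q b ∪ Q c) in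
    ⊓ M L S + ⊓* M L S + (⊓ M (Q a) (Q b ∪ Q c) + ⊓* M (Q a) (Q b ∪ Q c)) ≤ 2 + λ' M (Q b ∪ Q c)
  ⊓+⊓*-L-triple≤ {a} {b} {c} a≢b a≢c b≢c = begin
    ⊓ M L S + ⊓* M L S + w                     ≤⟨ +-monoˡ-≤ w ⊓+⊓*≤λS ⟩
    λ' M S + w                                 ≡⟨ +-comm (λ' M S) w ⟩
    w + λ' M S                                 ≡⟨ ⊓+⊓* (Q a) (Q b ∪ Q c) Qa∩Qb∪Qc≡∅ ⟩
    λ' M (Q a) + λ' M (Q b ∪ Q c)              ≡⟨ cong (_+ λ' M (Q b ∪ Q c)) (λQ≡2 a) ⟩
    2 + λ' M (Q b ∪ Q c)                       ∎
    where
    open ≤-Reasoning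
    S = Q a ∪ (Q b ∪ Q c)
    w = ⊓ M (Q a) (Q b ∪ Q c) + ⊓* M (Q a) (Q b ∪ Q c)
    Qa∩Qb∪Qc≡∅ : Empty (Q a ∩ (Q b ∪ Q c))
    Qa∩Qb∪Qc≡∅ = disjoint-sym (disjoint-∪ (Q∩Q≡∅ b a (≢-sym a≢b)) (Q∩Q≡∅ c a (≢-sym a≢c)))
    L∩S≡∅ : Empty (L ∩ S)
    L∩S≡∅ = disjoint-sym (disjoint-∪ (disjoint-sym (L∩Q≡∅ a)) (disjoint-sym L∩Q∪Q≡∅))
    L∪S⊆∁R : L ∪ S ⊆ ∁ R
    L∪S⊆∁R = ∪-⊆-∁ L∩R≡∅ (disjoint-∪ (Q∩R≡∅ a) (disjoint-∪ (Q∩R≡∅ b) (Q∩R≡∅ c)))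
    ⊓+⊓*≤λS : ⊓ M L S + ⊓* M L S ≤ λ' M S
    ⊓+⊓*≤λS = +-cancelʳ-≤ 3 _ _ (begin
      ⊓ M L S + ⊓* M L S + 3               ≤⟨ +-monoʳ-≤ _ (κ≥3 (L ∪ S) (p⊆p∪q S) L∪S⊆∁R) ⟩
      ⊓ M L S + ⊓* M L S + λ' M (L ∪ S)    ≡⟨ ⊓+⊓* L S L∩S≡∅ ⟩
      λ' M L + λ' M S                      ≡⟨ cong (_+ λ' M S) λL≡3 ⟩
      3 + λ' M S                           ≡⟨ +-comm 3 (λ' M S) ⟩
      λ' M S + 3                           ∎)

module _ {m : ℕ} where

  ∈-⋃-take⁻ : ∀ {n} k (P : Fin n → Subset m) {x : Fin m} →
              x ∈ ⋃ (take k (tabulate P)) → ∃[ t ] (toℕ t < k × x ∈ P t)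
  ∈-⋃-take⁻ zero            P x∈ = contradiction x∈ ∉⊥
  ∈-⋃-take⁻ {zero}  (suc k) P x∈ = contradiction x∈ ∉⊥
  ∈-⋃-take⁻ {suc n} (suc k) P x∈ with x∈p∪q⁻ (P zero) _ x∈
  ... | inj₁ x∈P₀ = zero , s≤s z≤n , x∈P₀
  ... | inj₂ x∈⋃ with ∈-⋃-take⁻ k (λ t → P (suc t)) x∈⋃
  ...   | t , t<k , x∈Pt = suc t , s≤s t<k , x∈Pt

  ∈-⋃-take⁺ : ∀ {n} k (P : Fin n → Subset m) {x : Fin m} {t : Fin n} →
              toℕ t < k → x ∈ P t → x ∈ ⋃ (take k (tabulate P))
  ∈-⋃-take⁺ {suc n} (suc k) P {t = zero}  _         x∈P₀ = x∈p∪q⁺ (inj₁ x∈P₀)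
  ∈-⋃-take⁺ {suc n} (suc k) P {t = suc t} (s≤s t<k) x∈Pt =
    x∈p∪q⁺ (inj₂ (∈-⋃-take⁺ k (λ t → P (suc t)) t<k x∈Pt))

toℕ<-of-≢fromℕ : ∀ {k} (t : Fin (suc k)) → t ≢ fromℕ k → toℕ t < k
toℕ<-of-≢fromℕ {k} t t≢k with m≤n⇒m<n∨m≡n (toℕ≤pred[n] t)
... | inj₁ t<k = t<k
... | inj₂ t≡k = contradiction (toℕ-injective (trans t≡k (sym (toℕ-fromℕ k)))) t≢k

transpose-maps : ∀ {n} (i j : Fin n) → Perm.transpose i j ⟨$⟩ʳ i ≡ j
transpose-maps i j rewrite dec-true (i ≟ i) refl = refl

module FromFlexipath {m : ℕ} (M : Matroid m) {k : ℕ} (L : Subset m)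
                     (Q : Fin (suc k) → Subset m) (R : Subset m)
                     (P : Is42Flexipath M (suc k) L Q R) where
  open Connectivity M using (λ-∁)

  λ-prefix : ∀ (σ : Permutation′ (suc k)) (K : Fin (suc (suc k))) →
             λ' M (L ∪ ⋃ (take (toℕ K) (map (λ i → Q (σ ⟨$⟩ʳ i)) (allFin (suc k))))) ≡ 3
  λ-prefix σ K = proj₂ (proj₂ (proj₁ P σ)) K

  private
    partition : IsOrderedPartition M (suc k) L Q R
    partition = proj₁ (proj₁ P Perm.id)

    L∩R≡∅ : Empty (L ∩ R)
    L∩R≡∅ = proj₁ partition
    L∩Q≡∅ : ∀ i → Empty (L ∩ Q i)
    L∩Q≡∅ = proj₁ (proj₂ partition)
    Q∩R≡∅ : ∀ i → Empty (Q i ∩ R)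
    Q∩R≡∅ = proj₁ (proj₂ (proj₂ partition))
    Q∩Q≡∅ : ∀ i j → i ≢ j → Empty (Q i ∩ Q j)
    Q∩Q≡∅ = proj₁ (proj₂ (proj₂ (proj₂ partition)))
    covers : ∀ x → x ∈ L ⊎ (∃[ i ] x ∈ Q i) ⊎ x ∈ R
    covers = proj₂ (proj₂ (proj₂ (proj₂ partition)))

    prefix-complement : ∀ i → let σ = Perm.transpose (fromℕ k) i in
      L ∪ ⋃ (take k (tabulate (λ t → Q (σ ⟨$⟩ʳ t)))) ≡ ∁ (R ∪ Q i)
    prefix-complement i = ⊆-antisym ⊆∁ ∁⊆
      where
      σ = Perm.transpose (fromℕ k) i
      σ-last : σ ⟨$⟩ʳ fromℕ k ≡ i
      σ-last = transpose-maps (fromℕ k) i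
      prefix = ⋃ (take k (tabulate (λ t → Q (σ ⟨$⟩ʳ t))))

      ⊆∁ : L ∪ prefix ⊆ ∁ (R ∪ Q i)
      ⊆∁ {x} x∈ with x∈p∪q⁻ L prefix x∈
      ... | inj₁ x∈L = x∉p⇒x∈∁p (∉-∪ (∉-of-disjoint L∩R≡∅ x∈L) (∉-of-disjoint (L∩Q≡∅ i) x∈L))
      ... | inj₂ x∈prefix with ∈-⋃-take⁻ k (λ u → Q (σ ⟨$⟩ʳ u)) x∈prefix
      ...   | t , t<k , x∈Qσt =
        x∉p⇒x∈∁p (∉-∪ (∉-of-disjoint (Q∩R≡∅ (σ ⟨$⟩ʳ t)) x∈Qσt)
                      (∉-of-disjoint (Q∩Q≡∅ _ i σt≢i) x∈Qσt))
        where
        t≢last : t ≢ fromℕ k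
        t≢last t≡last = <-irrefl (toℕ-fromℕ k) (subst (λ u → toℕ u < k) t≡last t<k)
        σt≢i : σ ⟨$⟩ʳ t ≢ i
        σt≢i σt≡i = t≢last (begin
          t                          ≡⟨ Perm.inverseˡ σ ⟨
          σ ⟨$⟩ˡ (σ ⟨$⟩ʳ t)          ≡⟨ cong (σ ⟨$⟩ˡ_) (trans σt≡i (sym σ-last)) ⟩
          σ ⟨$⟩ˡ (σ ⟨$⟩ʳ fromℕ k)    ≡⟨ Perm.inverseˡ σ ⟩
          fromℕ k                    ∎)
          where open ≡-Reasoning

      ∁⊆ : ∁ (R ∪ Q i) ⊆ L ∪ prefix
      ∁⊆ {x} x∈∁ with covers x
      ... | inj₁ x∈L = x∈p∪q⁺ (inj₁ x∈L)
      ... | inj₂ (inj₂ x∈R) = contradiction (x∈p∪q⁺ (inj₁ x∈R)) (x∈∁p⇒x∉p x∈∁)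
      ... | inj₂ (inj₁ (j , x∈Qj)) =
        x∈p∪q⁺ (inj₂ (∈-⋃-take⁺ k (λ u → Q (σ ⟨$⟩ʳ u)) (toℕ<-of-≢fromℕ t t≢last)
                         (subst (λ u → x ∈ Q u) (sym (Perm.inverseʳ σ)) x∈Qj)))
        where
        t = σ ⟨$⟩ˡ j
        t≢last : t ≢ fromℕ k
        t≢last t≡last = x∈∁p⇒x∉p x∈∁ (x∈p∪q⁺ (inj₂ (subst (λ u → x ∈ Q u) j≡i x∈Qj)))
          where
          j≡i : j ≡ i
          j≡i = trans (sym (Perm.inverseʳ σ)) (trans (cong (σ ⟨$⟩ʳ_) t≡last) σ-last)

  flexipath-facts : FlexipathFacts M (suc k) L Q R
  flexipath-facts = record
    { L∩R≡∅  = L∩R≡∅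
    ; L∩Q≡∅  = L∩Q≡∅
    ; Q∩R≡∅  = Q∩R≡∅
    ; Q∩Q≡∅  = Q∩Q≡∅
    ; covers = covers
    ; λL≡3   = subst (λ Z → λ' M Z ≡ 3) (∪-identityʳ L) (λ-prefix Perm.id zero)
    ; λL∪Q≡3 = λL∪Q≡3
    ; λR∪Q≤3 = λ i → ≤-reflexive (λR∪Q≡3 i)
    ; κ≥3    = proj₂ (proj₁ (proj₂ (proj₁ P Perm.id)))
    ; λQ≡2   = proj₁ (proj₂ P)
    ; λQ∪Q≥3 = proj₂ (proj₂ P)
    }
    where
    λL∪Q≡3 : ∀ i → λ' M (L ∪ Q i) ≡ 3
    λL∪Q≡3 i = subst (λ Z → λ' M (L ∪ Z) ≡ 3)
      (trans (∪-identityʳ _) (cong Q (transpose-maps zero i)))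
      (λ-prefix (Perm.transpose zero i) (suc zero))

    λR∪Q≡3 : ∀ i → λ' M (R ∪ Q i) ≡ 3
    λR∪Q≡3 i = begin
      λ' M (R ∪ Q i)
        ≡⟨ λ-∁ (R ∪ Q i) ⟨
      λ' M (∁ (R ∪ Q i))
        ≡⟨ cong (λ' M) (prefix-complement i) ⟨
      λ' M (L ∪ ⋃ (take k (tabulate (λ t → Q (σ ⟨$⟩ʳ t)))))
        ≡⟨ cong₂ (λ K T → λ' M (L ∪ ⋃ (take K T)))
                 (trans (toℕ-inject₁ (fromℕ k)) (toℕ-fromℕ k)) (map-tabulate (λ t → t) _) ⟨
      λ' M (L ∪ ⋃ (take (toℕ (inject₁ (fromℕ k))) (map (λ t → Q (σ ⟨$⟩ʳ t)) (allFin (suc k)))))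
        ≡⟨ λ-prefix σ (inject₁ (fromℕ k)) ⟩
      3 ∎
      where
      σ = Perm.transpose (fromℕ k) i
      open ≡-Reasoning

open FromFlexipath using (flexipath-facts)

PairsAre : ∀ {m} (M : Matroid m) {n} (Q : Fin n → Subset m) → ℕ → ℕ → Set
PairsAre M {n} Q u v = ∀ (i j : Fin n) → ¬ i ≡ j → ⊓ M (Q i) (Q j) ≡ u × ⊓* M (Q i) (Q j) ≡ v

dual-pairs : ∀ {m} {M : Matroid m} {n} {Q : Fin n → Subset m} {u v} →
             PairsAre (M *) Q u v → PairsAre M Q v u
dual-pairs {M = M} {Q = Q} P i j i≢j =
  trans (sym (Duality.⊓*-dual M (Q i) (Q j))) (proj₂ (P i j i≢j)) , proj₁ (P i j i≢j)

module _ {m : ℕ} {M : Matroid m} {n : ℕ} {Q : Fin n → Subset m} {A B : Set}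
         {i j : Fin n} (i≢j : i ≢ j) where

  private
    clash : ∀ {u v u′ v′} → PairsAre M Q u v → PairsAre M Q u′ v′ → u ≡ u′ × v ≡ v′
    clash P P′ = trans (sym (proj₁ (P i j i≢j))) (proj₁ (P′ i j i≢j)) ,
                 trans (sym (proj₂ (P i j i≢j))) (proj₂ (P′ i j i≢j))

  exactly-01 : PairsAre M Q 0 1 →
               ExactlyOne (PairsAre M Q 0 1) (PairsAre M Q 1 0) (A × PairsAre M Q 0 0 × B)
  exactly-01 P = inj₁ (P , (λ P′ → case proj₁ (clash P P′) of λ ()) ,
                           (λ { (_ , P′ , _) → case proj₂ (clash P P′) of λ () }))

  exactly-10 : PairsAre M Q 1 0 →
               ExactlyOne (PairsAre M Q 0 1) (PairsAre M Q 1 0) (A × PairsAre M Q 0 0 × B)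
  exactly-10 P = inj₂ (inj₁ ((λ P′ → case proj₁ (clash P P′) of λ ()) , P ,
                             (λ { (_ , P′ , _) → case proj₁ (clash P P′) of λ () })))

  exactly-00 : A → PairsAre M Q 0 0 → B →
               ExactlyOne (PairsAre M Q 0 1) (PairsAre M Q 1 0) (A × PairsAre M Q 0 0 × B)
  exactly-00 a P b = inj₂ (inj₂ ((λ P′ → case proj₂ (clash P P′) of λ ()) ,
                                 (λ P′ → case proj₁ (clash P P′) of λ ()) , a , P , b))

≤2-cases : ∀ {a} → a ≤ 2 → a ≡ 0 ⊎ a ≡ 1 ⊎ a ≡ 2
≤2-cases z≤n             = inj₁ refl
≤2-cases (s≤s z≤n)       = inj₂ (inj₁ refl)
≤2-cases (s≤s (s≤s z≤n)) = inj₂ (inj₂ refl)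

+≤1-cases : ∀ {a b} → a + b ≤ 1 → (a ≡ 0 × b ≡ 0) ⊎ (a ≡ 0 × b ≡ 1) ⊎ (a ≡ 1 × b ≡ 0)
+≤1-cases {zero}        {zero}        _        = inj₁ (refl , refl)
+≤1-cases {zero}        {suc zero}    _        = inj₂ (inj₁ (refl , refl))
+≤1-cases {zero}        {suc (suc b)} (s≤s ())
+≤1-cases {suc zero}    {zero}        _        = inj₂ (inj₂ (refl , refl))
+≤1-cases {suc zero}    {suc b}       (s≤s ())
+≤1-cases {suc (suc a)} {b}           (s≤s ())

+≡1-cases : ∀ {a b} → a + b ≡ 1 → (a ≡ 0 × b ≡ 1) ⊎ (a ≡ 1 × b ≡ 0)
+≡1-cases {zero}                refl = inj₁ (refl , refl)
+≡1-cases {suc zero}    {zero}  refl = inj₂ (refl , refl)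
+≡1-cases {suc zero}    {suc b} ()
+≡1-cases {suc (suc a)}         ()

one-of-pair≡2 : ∀ {a₀ a₁ b₀ b₁} → a₀ + b₀ ≡ 2 → a₁ + b₁ ≡ 2 → b₀ + b₁ ≤ 1 → a₀ ≡ 2 ⊎ a₁ ≡ 2
one-of-pair≡2 {b₀ = zero}                e₀ _  _ = inj₁ (trans (sym (+-identityʳ _)) e₀)
one-of-pair≡2 {b₀ = suc _}  {b₁ = zero}  _  e₁ _ = inj₂ (trans (sym (+-identityʳ _)) e₁)
one-of-pair≡2 {b₀ = suc b₀} {b₁ = suc _} _  _  (s≤s b₀+1+b₁≤0) =
  contradiction (m+n≤o⇒n≤o b₀ b₀+1+b₁≤0) λ ()

-- Two steps

module TwoSteps {m : ℕ} {M : Matroid m} {L : Subset m} {Q : Fin 2 → Subset m} {R : Subset m}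
                (F : FlexipathFacts M 2 L Q R) where
  open FlexipathFacts F
  open FlexipathLemmas F
  open Connectivity M
  open Duality M using (⊓+⊓*)
  private module DualConnectivity = Connectivity (M *)

  Q₀ Q₁ : Subset m
  Q₀ = Q zero
  Q₁ = Q (suc zero)

  Q₀∪Q₁⊆∁R∪L : Q₀ ∪ Q₁ ⊆ ∁ (R ∪ L)
  Q₀∪Q₁⊆∁R∪L = ⊆-∁-∪ (disjoint-sym (disjoint-∪ (Q∩R≡∅ zero) (Q∩R≡∅ (suc zero)))) L∩Q∪Q≡∅

  ∁R∪L≡Q₀∪Q₁ : ∁ (R ∪ L) ≡ Q₀ ∪ Q₁
  ∁R∪L≡Q₀∪Q₁ = ⊆-antisym ⊆Q₀∪Q₁ Q₀∪Q₁⊆∁R∪L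
    where
    ⊆Q₀∪Q₁ : ∁ (R ∪ L) ⊆ Q₀ ∪ Q₁
    ⊆Q₀∪Q₁ {x} x∈∁ with covers x
    ... | inj₁ x∈L                     = contradiction (x∈p∪q⁺ (inj₂ x∈L)) (x∈∁p⇒x∉p x∈∁)
    ... | inj₂ (inj₁ (zero , x∈Q₀))     = x∈p∪q⁺ (inj₁ x∈Q₀)
    ... | inj₂ (inj₁ (suc zero , x∈Q₁)) = x∈p∪q⁺ (inj₂ x∈Q₁)
    ... | inj₂ (inj₂ x∈R)              = contradiction (x∈p∪q⁺ (inj₁ x∈R)) (x∈∁p⇒x∉p x∈∁)

  pairs-of-two-steps : ∀ {u v} → ⊓ M Q₀ Q₁ ≡ u → ⊓* M Q₀ Q₁ ≡ v → PairsAre M Q u v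
  pairs-of-two-steps ⊓≡u ⊓*≡v zero       (suc zero) _   = ⊓≡u , ⊓*≡v
  pairs-of-two-steps ⊓≡u ⊓*≡v (suc zero) zero       _   =
    trans (⊓-comm Q₁ Q₀) ⊓≡u , trans (DualConnectivity.⊓-comm Q₁ Q₀) ⊓*≡v
  pairs-of-two-steps ⊓≡u ⊓*≡v zero       zero       0≢0 = contradiction refl 0≢0
  pairs-of-two-steps ⊓≡u ⊓*≡v (suc zero) (suc zero) 1≢1 = contradiction refl 1≢1

  module _ (λR≡3 : λ' M R ≡ 3) (⊓+⊓*≡0 : ⊓ M Q₀ Q₁ + ⊓* M Q₀ Q₁ ≡ 0) where

    λR∪L≡4 : λ' M (R ∪ L) ≡ 4
    λR∪L≡4 = begin
      λ' M (R ∪ L)                                ≡⟨ λ-∁ (R ∪ L) ⟨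
      λ' M (∁ (R ∪ L))                            ≡⟨ cong (λ' M) ∁R∪L≡Q₀∪Q₁ ⟩
      λ' M (Q₀ ∪ Q₁)                              ≡⟨ cong (_+ λ' M (Q₀ ∪ Q₁)) ⊓+⊓*≡0 ⟨
      ⊓ M Q₀ Q₁ + ⊓* M Q₀ Q₁ + λ' M (Q₀ ∪ Q₁)     ≡⟨ ⊓+⊓* Q₀ Q₁ (Q∩Q≡∅ zero (suc zero) λ ()) ⟩
      λ' M Q₀ + λ' M Q₁                           ≡⟨ cong₂ _+_ (λQ≡2 zero) (λQ≡2 (suc zero)) ⟩
      4                                           ∎
      where open ≡-Reasoning

    ⊓+⊓*-L-R≡2 : ⊓ M L R + ⊓* M L R ≡ 2
    ⊓+⊓*-L-R≡2 = +-cancelʳ-≡ 4 (⊓ M L R + ⊓* M L R) 2 (begin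
      ⊓ M L R + ⊓* M L R + 4
        ≡⟨ cong₂ (λ a b → a + b + 4) (⊓-comm R L) (DualConnectivity.⊓-comm R L) ⟨
      ⊓ M R L + ⊓* M R L + 4
        ≡⟨ cong (⊓ M R L + ⊓* M R L +_) λR∪L≡4 ⟨
      ⊓ M R L + ⊓* M R L + λ' M (R ∪ L)
        ≡⟨ ⊓+⊓* R L (disjoint-sym L∩R≡∅) ⟩
      λ' M R + λ' M L
        ≡⟨ cong₂ _+_ λR≡3 λL≡3 ⟩
      6 ∎)
      where open ≡-Reasoning

    ⊓-L-Q+⊓-L-Q≤ : ⊓ M L Q₀ + ⊓ M L Q₁ ≤ suc (⊓ M L R)
    ⊓-L-Q+⊓-L-Q≤ = +-cancelʳ-≤ 3 _ _ (begin
      ⊓ M L Q₀ + ⊓ M L Q₁ + 3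
        ≡⟨ cong (⊓ M L Q₀ + ⊓ M L Q₁ +_) λR≡3 ⟨
      ⊓ M L Q₀ + ⊓ M L Q₁ + λ' M R
        ≤⟨ ⊓+⊓-≤ L Q₀ Q₁ R (disjoint-sym L∩R≡∅) Q₀∪Q₁⊆∁R∪L ⟩
      ⊓ M R L + λ' M (R ∪ L) + ⊓ M Q₀ Q₁
        ≡⟨ cong₂ _+_ (cong₂ _+_ (⊓-comm R L) λR∪L≡4) (m+n≡0⇒m≡0 _ ⊓+⊓*≡0) ⟩
      ⊓ M L R + 4 + 0
        ≡⟨ trans (+-identityʳ (⊓ M L R + 4)) (+-suc (⊓ M L R) 3) ⟩
      suc (⊓ M L R) + 3 ∎)
      where open ≤-Reasoning

λR≡3-of-two-steps : ∀ {m} (M : Matroid m) L (Q : Fin 2 → Subset m) R →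
                    Is42Flexipath M 2 L Q R → λ' M R ≡ 3
λR≡3-of-two-steps M L Q R P = begin
  λ' M R                                     ≡⟨ Connectivity.λ-∁ M R ⟨
  λ' M (∁ R)                                 ≡⟨ cong (λ' M) (∪-∁-∪ R L (disjoint-sym L∩R≡∅)) ⟨
  λ' M (L ∪ ∁ (R ∪ L))                       ≡⟨ cong (λ Z → λ' M (L ∪ Z)) (TwoSteps.∁R∪L≡Q₀∪Q₁ F) ⟩
  λ' M (L ∪ (Q zero ∪ Q (suc zero)))
    ≡⟨ cong (λ Z → λ' M (L ∪ (Q zero ∪ Z))) (∪-identityʳ _) ⟨
  λ' M (L ∪ (Q zero ∪ (Q (suc zero) ∪ ⊥)))
    ≡⟨ FromFlexipath.λ-prefix M L Q R P Perm.id (suc (suc zero)) ⟩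
  3                                          ∎
  where
  open ≡-Reasoning
  F = flexipath-facts M L Q R P
  open FlexipathFacts F using (L∩R≡∅)

module _ {m : ℕ} {M : Matroid m} {L : Subset m} {Q : Fin 2 → Subset m} {R : Subset m} where

  -- ⊓(L,R) = 2 leaves ⊓*(L,R) = 0, so the dual bound gives ⊓*(L,Q₀) + ⊓*(L,Q₁) ≤ 1,
  -- hence some ⊓(L,Qᵢ) = 2.
  special-of-two-steps : (F : FlexipathFacts M 2 L Q R) → λ' M R ≡ 3 →
    ⊓ M (Q zero) (Q (suc zero)) + ⊓* M (Q zero) (Q (suc zero)) ≡ 0 → ⊓ M L R ≡ 2 →
    ∃ (SpecialIn M L Q R)
  special-of-two-steps F λR≡3 ⊓+⊓*≡0 ⊓-L-R≡2
    with one-of-pair≡2 (⊓+⊓*-L-Q zero) (⊓+⊓*-L-Q (suc zero)) ⊓*-sum≤1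
    where
    open TwoSteps F
    open FlexipathLemmas F using (⊓+⊓*-L-Q)
    module D = TwoSteps (dual-facts F)
    ⊓*-L-R≡0 : ⊓* M L R ≡ 0
    ⊓*-L-R≡0 = +-cancelˡ-≡ 2 (⊓* M L R) 0
      (trans (cong (_+ ⊓* M L R) (sym ⊓-L-R≡2)) (⊓+⊓*-L-R≡2 λR≡3 ⊓+⊓*≡0))
    dual-sum≡0 : ⊓* M Q₀ Q₁ + ⊓* (M *) Q₀ Q₁ ≡ 0
    dual-sum≡0 = trans (cong (⊓* M Q₀ Q₁ +_) (Duality.⊓*-dual M Q₀ Q₁))
                       (trans (+-comm (⊓* M Q₀ Q₁) _) ⊓+⊓*≡0)
    ⊓*-sum≤1 : ⊓* M L Q₀ + ⊓* M L Q₁ ≤ 1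
    ⊓*-sum≤1 = subst (λ t → ⊓* M L Q₀ + ⊓* M L Q₁ ≤ suc t) ⊓*-L-R≡0
      (D.⊓-L-Q+⊓-L-Q≤ (trans (Duality.λ-dual M R) λR≡3) dual-sum≡0)
  ... | inj₁ α≡2 = zero     , ⊓-L-R≡2 , α≡2 , trans (FlexipathLemmas.⊓-R-Q≡⊓-L-Q F zero) α≡2
  ... | inj₂ α≡2 = suc zero , ⊓-L-R≡2 , α≡2 , trans (FlexipathLemmas.⊓-R-Q≡⊓-L-Q F (suc zero)) α≡2

module _ {m : ℕ} {M : Matroid m} {L : Subset m} {Q : Fin 2 → Subset m} {R : Subset m}
         (F : FlexipathFacts M 2 L Q R) (λR≡3 : λ' M R ≡ 3)
         (not-special : ∀ i → ¬ SpeciallyPlaced M L Q R i) where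
  open TwoSteps F

  private
    0≢1 : _≢_ {A = Fin 2} zero (suc zero)
    0≢1 ()

    unconnected : ⊓ M Q₀ Q₁ ≡ 0 → ⊓* M Q₀ Q₁ ≡ 0 →
      ExactlyOne (PairsAre M Q 0 1) (PairsAre M Q 1 0)
                 (2 ≡ 2 × PairsAre M Q 0 0 × ⊓ M L R ≡ 1 × ⊓* M L R ≡ 1)
    unconnected ⊓≡0 ⊓*≡0 with ≤2-cases (subst (⊓ M L R ≤_) ⊓+⊓*≡2 (m≤m+n (⊓ M L R) (⊓* M L R)))
      where
      ⊓+⊓*≡2 : ⊓ M L R + ⊓* M L R ≡ 2
      ⊓+⊓*≡2 = ⊓+⊓*-L-R≡2 λR≡3 (cong₂ _+_ ⊓≡0 ⊓*≡0)
    ... | inj₁ ⊓-L-R≡0 =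
      let i , special = special-of-two-steps (dual-facts F) λ*R≡3 dual-sum≡0 ⊓*-L-R≡2
      in contradiction (inj₂ special) (not-special i)
      where
      λ*R≡3 : λ' (M *) R ≡ 3
      λ*R≡3 = trans (Duality.λ-dual M R) λR≡3
      ⊓*-L-R≡2 : ⊓* M L R ≡ 2
      ⊓*-L-R≡2 = trans (sym (cong (_+ ⊓* M L R) ⊓-L-R≡0)) (⊓+⊓*-L-R≡2 λR≡3 (cong₂ _+_ ⊓≡0 ⊓*≡0))
      dual-sum≡0 : ⊓* M Q₀ Q₁ + ⊓* (M *) Q₀ Q₁ ≡ 0
      dual-sum≡0 = trans (cong (⊓* M Q₀ Q₁ +_) (Duality.⊓*-dual M Q₀ Q₁)) (cong₂ _+_ ⊓*≡0 ⊓≡0)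
    ... | inj₂ (inj₁ ⊓-L-R≡1) =
      exactly-00 {M = M} {Q = Q} 0≢1 refl (pairs-of-two-steps ⊓≡0 ⊓*≡0) (⊓-L-R≡1 , ⊓*-L-R≡1)
      where
      ⊓*-L-R≡1 : ⊓* M L R ≡ 1
      ⊓*-L-R≡1 = +-cancelˡ-≡ 1 (⊓* M L R) 1
        (trans (sym (cong (_+ ⊓* M L R) ⊓-L-R≡1)) (⊓+⊓*-L-R≡2 λR≡3 (cong₂ _+_ ⊓≡0 ⊓*≡0)))
    ... | inj₂ (inj₂ ⊓-L-R≡2) =
      let i , special = special-of-two-steps F λR≡3 (cong₂ _+_ ⊓≡0 ⊓*≡0) ⊓-L-R≡2
      in contradiction (inj₁ special) (not-special i)

  two-steps : ExactlyOne (PairsAre M Q 0 1) (PairsAre M Q 1 0)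
                         (2 ≡ 2 × PairsAre M Q 0 0 × ⊓ M L R ≡ 1 × ⊓* M L R ≡ 1)
  two-steps with +≤1-cases (FlexipathLemmas.⊓+⊓*-Q-Q≤1 F 0≢1)
  ... | inj₁ (⊓≡0 , ⊓*≡0)        = unconnected ⊓≡0 ⊓*≡0
  ... | inj₂ (inj₁ (⊓≡0 , ⊓*≡1)) = exactly-01 {M = M} {Q = Q} 0≢1 (pairs-of-two-steps ⊓≡0 ⊓*≡1)
  ... | inj₂ (inj₂ (⊓≡1 , ⊓*≡0)) = exactly-10 {M = M} {Q = Q} 0≢1 (pairs-of-two-steps ⊓≡1 ⊓*≡0)

-- At least four steps

two-other-indices : ∀ {k} {i j : Fin (suc (suc (suc (suc k))))} → i ≢ j →
                    ∃[ p ] ∃[ q ] (p ≢ q × p ≢ i × p ≢ j × q ≢ i × q ≢ j)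
two-other-indices {i = i} {j} i≢j =
  p , q , p≢q , punchInᵢ≢i i _ , avoids-j zero , punchInᵢ≢i i _ , avoids-j (suc zero)
  where
  j′ = punchOut i≢j
  p = punchIn i (punchIn j′ zero)
  q = punchIn i (punchIn j′ (suc zero))
  avoids-j : ∀ t → punchIn i (punchIn j′ t) ≢ j
  avoids-j t eq = punchInᵢ≢i j′ t (punchIn-injective i _ _ (trans eq (sym (punchIn-punchOut i≢j))))
  p≢q : p ≢ q
  p≢q eq = case punchIn-injective j′ _ _ (punchIn-injective i _ _ eq) of λ ()

module ManySteps {m : ℕ} {M : Matroid m} {k : ℕ} {L : Subset m}
                 {Q : Fin (suc (suc (suc (suc k)))) → Subset m} {R : Subset m}
                 (F : FlexipathFacts M (suc (suc (suc (suc k)))) L Q R) where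
  open FlexipathFacts F
  open FlexipathLemmas F
  open Connectivity M
  open Duality M using (⊓+⊓*; ⊓*-dual)
  private
    module DualLemmas = FlexipathLemmas (dual-facts F)
    module DualConnectivity = Connectivity (M *)

  -- This is where the two further steps p and q, hence n ≥ 4, are needed.
  λ-Q∪Q≡3 : ∀ {i j} → i ≢ j → λ' M (Q i ∪ Q j) ≡ 3
  λ-Q∪Q≡3 {i} {j} i≢j with two-other-indices i≢j
  ... | p , q , p≢q , p≢i , p≢j , q≢i , q≢j = ≤-antisym λ≤3 (λQ∪Q≥3 i j i≢j)
    where
    Q∩Qp∪Qq≡∅ : ∀ {t} → p ≢ t → q ≢ t → Empty (Q t ∩ (Q p ∪ Q q))
    Q∩Qp∪Qq≡∅ {t} p≢t q≢t = disjoint-sym (disjoint-∪ (Q∩Q≡∅ p t p≢t) (Q∩Q≡∅ q t q≢t))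
    λ≤3 : λ' M (Q i ∪ Q j) ≤ 3
    λ≤3 = +-cancelʳ-≤ 3 (λ' M (Q i ∪ Q j)) 3 (begin
      λ' M (Q i ∪ Q j) + 3
        ≤⟨ +-monoʳ-≤ (λ' M (Q i ∪ Q j)) (λQ∪Q≥3 p q p≢q) ⟩
      λ' M (Q i ∪ Q j) + λ' M (Q p ∪ Q q)
        ≤⟨ λ+λ-≤ L (Q i ∪ Q j) (Q p ∪ Q q) L∩Q∪Q≡∅ L∩Q∪Q≡∅
                 (disjoint-∪ (Q∩Qp∪Qq≡∅ p≢i q≢i) (Q∩Qp∪Qq≡∅ p≢j q≢j)) ⟩
      λ' M (L ∪ (Q i ∪ Q j)) + λ' M (L ∪ (Q p ∪ Q q))
        ≤⟨ +-mono-≤ (λ-L∪Q∪Q≤3 i≢j) (λ-L∪Q∪Q≤3 p≢q) ⟩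
      3 + 3 ∎)
      where open ≤-Reasoning

  ⊓+⊓*-Q-Q≡1 : ∀ {i j} → i ≢ j → ⊓ M (Q i) (Q j) + ⊓* M (Q i) (Q j) ≡ 1
  ⊓+⊓*-Q-Q≡1 {i} {j} i≢j = +-cancelʳ-≡ 3 s 1 (begin
    s + 3                       ≡⟨ cong (s +_) (λ-Q∪Q≡3 i≢j) ⟨
    s + λ' M (Q i ∪ Q j)        ≡⟨ ⊓+⊓* (Q i) (Q j) (Q∩Q≡∅ i j i≢j) ⟩
    λ' M (Q i) + λ' M (Q j)     ≡⟨ cong₂ _+_ (λQ≡2 i) (λQ≡2 j) ⟩
    4                           ∎)
    where
    open ≡-Reasoning
    s = ⊓ M (Q i) (Q j) + ⊓* M (Q i) (Q j)

  ⊓*-L-Q≡ : ∀ {i a b} → ⊓ M L (Q i) ≡ a → a + b ≡ 2 → ⊓* M L (Q i) ≡ b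
  ⊓*-L-Q≡ {i} {a} {b} α≡a a+b≡2 = +-cancelˡ-≡ a (⊓* M L (Q i)) b (begin
    a + ⊓* M L (Q i)              ≡⟨ cong (_+ ⊓* M L (Q i)) α≡a ⟨
    ⊓ M L (Q i) + ⊓* M L (Q i)    ≡⟨ ⊓+⊓*-L-Q i ⟩
    2                             ≡⟨ a+b≡2 ⟨
    a + b                         ∎)
    where open ≡-Reasoning

  α-two-spreads : (∀ i → ¬ SpecialIn M L Q R i) → ∀ {i} j → ⊓ M L (Q i) ≡ 2 → ⊓ M L (Q j) ≡ 2
  α-two-spreads not-special {i} j α≡2 with j ≟ i
  ... | yes refl = α≡2
  ... | no j≢i with ≤2-cases (⊓-L-Q≤2 j)
  ...   | inj₂ (inj₂ α′≡2) = α′≡2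
  ...   | inj₂ (inj₁ α′≡1) = contradiction (special α≡2 α′≡1) (not-special i)
  ...   | inj₁ α′≡0 = contradiction (begin
      1                                    ≡⟨ ⊓+⊓*-Q-Q≡1 j≢i ⟨
      ⊓ M (Q j) (Q i) + ⊓* M (Q j) (Q i)   ≤⟨ +-mono-≤ (⊓-Q-Q≤⊓-L-Q j≢i) ⊓*≤ ⟩
      ⊓ M L (Q j) + ⊓* M L (Q i)           ≡⟨ cong₂ _+_ α′≡0 (⊓*-L-Q≡ α≡2 refl) ⟩
      0                                    ∎) λ ()
    where
    open ≤-Reasoning
    ⊓*≤ : ⊓* M (Q j) (Q i) ≤ ⊓* M L (Q i)
    ⊓*≤ = subst (_≤ ⊓* M L (Q i)) (DualConnectivity.⊓-comm (Q i) (Q j))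
                (DualLemmas.⊓-Q-Q≤⊓-L-Q (≢-sym j≢i))

  pairs-of-α-two : (∀ i → ⊓ M L (Q i) ≡ 2) → PairsAre M Q 1 0
  pairs-of-α-two α≡2 i j i≢j = ⊓≡1 , ⊓*≡0
    where
    ⊓*≡0 : ⊓* M (Q i) (Q j) ≡ 0
    ⊓*≡0 = n≤0⇒n≡0 (subst (⊓* M (Q i) (Q j) ≤_) (⊓*-L-Q≡ (α≡2 i) refl) (DualLemmas.⊓-Q-Q≤⊓-L-Q i≢j))
    ⊓≡1 : ⊓ M (Q i) (Q j) ≡ 1
    ⊓≡1 = trans (sym (+-identityʳ _))
                (trans (cong (⊓ M (Q i) (Q j) +_) (sym ⊓*≡0)) (⊓+⊓*-Q-Q≡1 i≢j))

  module _ (α≡1 : ∀ i → ⊓ M L (Q i) ≡ 1) where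

    -- For S = Q a ∪ Q b ∪ Q c one gets ⊓(L,S) ≥ ⊓(L, Q c ∪ Q a) ≥ 2 and
    -- ⊓*(L,S) ≥ ⊓*(L, Q b ∪ Q a) ≥ 2, whereas ⊓(L,S) + ⊓*(L,S) ≤ λ(S) ≤ 3.
    no-mixed-pair : ∀ {a b c} → a ≢ b → a ≢ c → b ≢ c →
                    ¬ (1 ≤ ⊓ M (Q a) (Q b) × 1 ≤ ⊓* M (Q a) (Q c))
    no-mixed-pair {a} {b} {c} a≢b a≢c b≢c (1≤⊓ , 1≤⊓*) = contradiction (begin
      6
        ≤⟨ +-mono-≤ (+-mono-≤ q≥2 p*≥2) (+-mono-≤ 1≤⊓ 1≤⊓*) ⟩
      q + p* + (⊓ M (Q a) (Q b) + ⊓* M (Q a) (Q c))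
        ≤⟨ +-mono-≤ (+-mono-≤ (⊓-mono L Qc∪Qa⊆S) (DualConnectivity.⊓-mono L Qb∪Qa⊆S))
                    (+-mono-≤ (⊓-mono (Q a) (p⊆p∪q (Q c)))
                              (DualConnectivity.⊓-mono (Q a) (q⊆p∪q (Q b) (Q c)))) ⟩
      ⊓ M L S + ⊓* M L S + (⊓ M (Q a) (Q b ∪ Q c) + ⊓* M (Q a) (Q b ∪ Q c))
        ≤⟨ ⊓+⊓*-L-triple≤ a≢b a≢c b≢c ⟩
      2 + λ' M (Q b ∪ Q c)
        ≡⟨ cong (2 +_) (λ-Q∪Q≡3 b≢c) ⟩
      5 ∎) λ { (s≤s (s≤s (s≤s (s≤s (s≤s ()))))) }
      where
      open ≤-Reasoning
      S  = Q a ∪ (Q b ∪ Q c)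
      p  = ⊓ M L (Q b ∪ Q a)
      p* = ⊓* M L (Q b ∪ Q a)
      q  = ⊓ M L (Q c ∪ Q a)
      q* = ⊓* M L (Q c ∪ Q a)
      Qb∪Qa⊆S : Q b ∪ Q a ⊆ S
      Qb∪Qa⊆S x∈ = [ (λ x∈Qb → q⊆p∪q (Q a) _ (p⊆p∪q (Q c) x∈Qb)) , p⊆p∪q _ ]′
                     (x∈p∪q⁻ (Q b) (Q a) x∈)
      Qc∪Qa⊆S : Q c ∪ Q a ⊆ S
      Qc∪Qa⊆S x∈ = [ (λ x∈Qc → q⊆p∪q (Q a) _ (q⊆p∪q (Q b) (Q c) x∈Qc)) , p⊆p∪q _ ]′
                     (x∈p∪q⁻ (Q c) (Q a) x∈)
      p≤1 : p ≤ 1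
      p≤1 = +-cancelʳ-≤ 2 p 1 (begin
        p + 2                                ≡⟨ +-assoc p 1 1 ⟨
        p + 1 + 1                            ≡⟨ cong (p + 1 +_) (⊓*-L-Q≡ (α≡1 a) refl) ⟨
        p + 1 + ⊓* M L (Q a)
          ≤⟨ +-monoˡ-≤ _ (+-monoʳ-≤ p (subst (1 ≤_) (⊓-comm (Q a) (Q b)) 1≤⊓)) ⟩
        p + ⊓ M (Q b) (Q a) + ⊓* M L (Q a)   ≤⟨ ⊓-L-Q∪Q≤ (≢-sym a≢b) ⟩
        ⊓ M L (Q b) + 2                      ≡⟨ cong (_+ 2) (α≡1 b) ⟩
        3                                    ∎)
      q*≤1 : q* ≤ 1
      q*≤1 = +-cancelʳ-≤ 2 q* 1 (begin
        q* + 2                                   ≡⟨ +-assoc q* 1 1 ⟨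
        q* + 1 + 1
          ≡⟨ cong (q* + 1 +_) (trans (⊓*-dual L (Q a)) (α≡1 a)) ⟨
        q* + 1 + ⊓* (M *) L (Q a)
          ≤⟨ +-monoˡ-≤ _ (+-monoʳ-≤ q* (subst (1 ≤_) (DualConnectivity.⊓-comm (Q a) (Q c)) 1≤⊓*)) ⟩
        q* + ⊓* M (Q c) (Q a) + ⊓* (M *) L (Q a) ≤⟨ DualLemmas.⊓-L-Q∪Q≤ (≢-sym a≢c) ⟩
        ⊓* M L (Q c) + 2                         ≡⟨ cong (_+ 2) (⊓*-L-Q≡ (α≡1 c) refl) ⟩
        3                                        ∎)
      p*≥2 : 2 ≤ p*
      p*≥2 = +-cancelˡ-≤ 1 2 p* (≤-trans (⊓+⊓*-L-Q∪Q≥3 (≢-sym a≢b)) (+-monoˡ-≤ p* p≤1))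
      q≥2 : 2 ≤ q
      q≥2 = +-cancelʳ-≤ 1 2 q (≤-trans (⊓+⊓*-L-Q∪Q≥3 (≢-sym a≢c)) (+-monoʳ-≤ q q*≤1))

    ⊓-locally-constant : ∀ {a b c} → a ≢ b → a ≢ c → ⊓ M (Q a) (Q b) ≡ ⊓ M (Q a) (Q c)
    ⊓-locally-constant {a} {b} {c} a≢b a≢c with b ≟ c
    ... | yes refl = refl
    ... | no b≢c with +≡1-cases (⊓+⊓*-Q-Q≡1 a≢b) | +≡1-cases (⊓+⊓*-Q-Q≡1 a≢c)
    ...   | inj₁ (⊓≡0 , _)  | inj₁ (⊓′≡0 , _)  = trans ⊓≡0 (sym ⊓′≡0)
    ...   | inj₂ (⊓≡1 , _)  | inj₂ (⊓′≡1 , _)  = trans ⊓≡1 (sym ⊓′≡1)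
    ...   | inj₁ (_ , ⊓*≡1) | inj₂ (⊓′≡1 , _)  =
      contradiction (≤-reflexive (sym ⊓′≡1) , ≤-reflexive (sym ⊓*≡1))
                    (no-mixed-pair a≢c a≢b (≢-sym b≢c))
    ...   | inj₂ (⊓≡1 , _)  | inj₁ (_ , ⊓*′≡1) =
      contradiction (≤-reflexive (sym ⊓≡1) , ≤-reflexive (sym ⊓*′≡1)) (no-mixed-pair a≢b a≢c b≢c)

    ⊓-from-zero : ∀ {j} → zero ≢ j → ⊓ M (Q zero) (Q j) ≡ ⊓ M (Q zero) (Q (suc zero))
    ⊓-from-zero 0≢j = ⊓-locally-constant 0≢j λ ()

    ⊓-constant : ∀ {i j} → i ≢ j → ⊓ M (Q i) (Q j) ≡ ⊓ M (Q zero) (Q (suc zero))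
    ⊓-constant {i} {j} i≢j with i ≟ zero | j ≟ zero
    ... | yes refl | _        = ⊓-from-zero i≢j
    ... | no i≢0   | yes refl = trans (⊓-comm (Q i) (Q zero)) (⊓-from-zero (≢-sym i≢0))
    ... | no i≢0   | no j≢0   =
      trans (⊓-locally-constant i≢j i≢0) (trans (⊓-comm (Q i) (Q zero)) (⊓-from-zero (≢-sym i≢0)))

    pairs-of-α-one : PairsAre M Q 0 1 ⊎ PairsAre M Q 1 0
    pairs-of-α-one with +≡1-cases (⊓+⊓*-Q-Q≡1 {zero} {suc zero} λ ())
    ... | inj₁ (⊓≡0 , _) = inj₁ λ i j i≢j →
      let ⊓≡0′ = trans (⊓-constant i≢j) ⊓≡0 in
      ⊓≡0′ , trans (sym (cong (_+ ⊓* M (Q i) (Q j)) ⊓≡0′)) (⊓+⊓*-Q-Q≡1 i≢j)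
    ... | inj₂ (⊓≡1 , _) = inj₂ λ i j i≢j →
      let ⊓≡1′ = trans (⊓-constant i≢j) ⊓≡1 in
      ⊓≡1′ , suc-injective (trans (sym (cong (_+ ⊓* M (Q i) (Q j)) ⊓≡1′)) (⊓+⊓*-Q-Q≡1 i≢j))

many-steps : ∀ {m} {M : Matroid m} {k L} {Q : Fin (suc (suc (suc (suc k)))) → Subset m} {R} →
             FlexipathFacts M (suc (suc (suc (suc k)))) L Q R →
             (∀ i → ¬ SpeciallyPlaced M L Q R i) → PairsAre M Q 0 1 ⊎ PairsAre M Q 1 0
many-steps {M = M} {L = L} {Q} {R} F not-special with ≤2-cases (FlexipathLemmas.⊓-L-Q≤2 F zero)
... | inj₂ (inj₂ α₀≡2) = inj₂ (pairs-of-α-two λ j → α-two-spreads not-special₁ j α₀≡2)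
  where
  open ManySteps F
  not-special₁ = λ i special → not-special i (inj₁ special)
... | inj₁ α₀≡0 =
  inj₁ (dual-pairs {M = M} (D.pairs-of-α-two λ j → D.α-two-spreads not-special₂ j α*₀≡2))
  where
  open ManySteps F
  module D = ManySteps (dual-facts F)
  not-special₂ = λ i special → not-special i (inj₂ special)
  α*₀≡2 : ⊓* M L (Q zero) ≡ 2
  α*₀≡2 = ⊓*-L-Q≡ α₀≡0 refl
... | inj₂ (inj₁ α₀≡1) = pairs-of-α-one α≡1
  where
  open ManySteps F
  module D = ManySteps (dual-facts F)
  α≡1 : ∀ j → ⊓ M L (Q j) ≡ 1
  α≡1 j with ≤2-cases (FlexipathLemmas.⊓-L-Q≤2 F j)
  ... | inj₂ (inj₁ α≡1) = α≡1
  ... | inj₂ (inj₂ α≡2) =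
    case trans (sym α₀≡1) (α-two-spreads (λ i sp → not-special i (inj₁ sp)) zero α≡2) of λ ()
  ... | inj₁ α≡0 =
    case trans (sym (⊓*-L-Q≡ α₀≡1 refl))
               (D.α-two-spreads (λ i sp → not-special i (inj₂ sp)) zero (⊓*-L-Q≡ α≡0 refl)) of λ ()

-- Squashed paths fall under (ii) and stretched ones under (i).
lemma5p14 : ∀ {m : ℕ} (M : Matroid m) (n : ℕ)
    (L : Subset m) (Q : Fin n → Subset m) (R : Subset m) →
    Is42Flexipath M n L Q R →
    n ≥ 2 → n ≢ 3 →
    ¬ Squashed M L Q R → ¬ Stretched M L Q R →
    (∀ i → ¬ SpeciallyPlaced M L Q R i) →
    ExactlyOne
      (∀ (i j : Fin n) → ¬ i ≡ j → ⊓ M (Q i) (Q j) ≡ 0 × ⊓* M (Q i) (Q j) ≡ 1)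
      (∀ (i j : Fin n) → ¬ i ≡ j → ⊓ M (Q i) (Q j) ≡ 1 × ⊓* M (Q i) (Q j) ≡ 0)
      (n ≡ 2
        × (∀ (i j : Fin n) → ¬ i ≡ j → ⊓ M (Q i) (Q j) ≡ 0 × ⊓* M (Q i) (Q j) ≡ 0)
        × ⊓ M L R ≡ 1 × ⊓* M L R ≡ 1)
lemma5p14 M 0 L Q R P () _
lemma5p14 M 1 L Q R P (s≤s ()) _
lemma5p14 M 2 L Q R P _ _ _ _ not-special =
  two-steps (flexipath-facts M L Q R P) (λR≡3-of-two-steps M L Q R P) not-special
lemma5p14 M 3 L Q R P _ n≢3 = contradiction refl n≢3
lemma5p14 M (suc (suc (suc (suc k)))) L Q R P _ _ _ _ not-special
  with many-steps (flexipath-facts M L Q R P) not-special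
... | inj₁ pairs = exactly-01 {M = M} {Q = Q} {i = zero} {suc zero} (λ ()) pairs
... | inj₂ pairs = exactly-10 {M = M} {Q = Q} {i = zero} {suc zero} (λ ()) pairs
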